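{- Let $r \geq 2$ be an integer. Let $G$ be an $r$-regular graph of order $n_1$ having an edge $e$ that is contained in precisely $c_1$ hamiltonian cycles of $G$. Let $H$ be a graph of order $n_2$ that has two vertices $u$ and $v$ of degree $r-1$ and $n_2-2$ vertices of degree $r$. Let $c_2$ be the number of hamiltonian $uv$-paths in $H$, and let $e'$ be an edge of $H$ that is contained in precisely $c_3$ hamiltonian $uv$-paths of $H$. Then for every integer $k \geq 1$ there exists an $r$-regular graph $G_k$ on $n := n_1 + k n_2$ vertices containing precisely $c_1 c_2 c_3^{k-1}$ hamiltonian cycles; in particular (with $G$ and $H$ fixed and $k \to \infty$) this number is $O\left(\left(\sqrt[n_2]{c_3}\right)^n\right)$.
   Context: All graphs are finite, simple and undirected. A hamiltonian $uv$-path is a path with endpoints $u$ and $v$ that visits every vertex of the graph exactly once. -}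

module Defs where

open import Data.Nat using (ℕ; zero; suc; _+_; _*_; _∸_; _^_; _≤_)
open import Data.Fin using (Fin; toℕ)
open import Data.Bool using (Bool; true; false)
open import Data.List using (List; length; filterᵇ; allFin)
open import Data.List.Membership.Propositional using (_∈_)
open import Data.List.Relation.Unary.Unique.Propositional using (Unique)
open import Data.Vec using (Vec; lookup)
open import Data.Product using (Σ; ∃; ∃-syntax; _×_; _,_)
open import Data.Sum using (_⊎_)
open import Relation.Binary.PropositionalEquality using (_≡_; _≢_)
open import Function.Definitions using (Bijective)
open import Function.Bundles using (_⇔_)

record Graph (n : ℕ) : Set where
  field
    adj   : Fin n → Fin n → Bool
    sym   : ∀ i j → adj i j ≡ adj j i
    irref : ∀ i → adj i i ≡ false
open Graph public

Adj : ∀ {n} → Graph n → Fin n → Fin n → Set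
Adj G i j = adj G i j ≡ true

deg : ∀ {n} → Graph n → Fin n → ℕ
deg {n} G i = length (filterᵇ (adj G i) (allFin n))

Regular : ∀ {n} → ℕ → Graph n → Set
Regular r G = ∀ i → deg G i ≡ r

-- A set of edges (spanning subgraph), as a symmetric-by-convention
-- Boolean matrix; entry (i , j) true means {i,j} is in the set.
EdgeSet : ℕ → Set
EdgeSet n = Vec (Vec Bool n) n

_∋ₑ_,_ : ∀ {n} → EdgeSet n → Fin n → Fin n → Set
E ∋ₑ i , j = lookup (lookup E i) j ≡ true

CycNext : ∀ {n} → Fin n → Fin n → Set
CycNext {n} a b = (toℕ b ≡ suc (toℕ a)) ⊎ (suc (toℕ a) ≡ n × toℕ b ≡ 0)

LinNext : ∀ {n} → Fin n → Fin n → Set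
LinNext a b = toℕ b ≡ suc (toℕ a)

EdgesOf : ∀ {n} → (Fin n → Fin n → Set) → (Fin n → Fin n) → EdgeSet n → Set
EdgesOf {n} Next p E =
  ∀ i j → (E ∋ₑ i , j) ⇔
    (∃[ a ] ∃[ b ] (Next a b × ((p a ≡ i × p b ≡ j) ⊎ (p a ≡ j × p b ≡ i))))

IsHamCycle : ∀ {n} → Graph n → EdgeSet n → Set
IsHamCycle {n} G E =
  3 ≤ n × Σ (Fin n → Fin n) λ p →
    Bijective _≡_ _≡_ p ×
    (∀ a b → CycNext a b → Adj G (p a) (p b)) ×
    EdgesOf CycNext p E

IsHamPath : ∀ {n} → Graph n → Fin n → Fin n → EdgeSet n → Set
IsHamPath {n} G u v E =
  Σ (Fin n → Fin n) λ p →
    Bijective _≡_ _≡_ p ×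
    (∀ a → toℕ a ≡ 0 → p a ≡ u) ×
    (∀ a → suc (toℕ a) ≡ n → p a ≡ v) ×
    (∀ a b → LinNext a b → Adj G (p a) (p b)) ×
    EdgesOf LinNext p E

HasExactly : ∀ {n} → ℕ → (EdgeSet n → Set) → Set
HasExactly {n} c P =
  Σ (List (EdgeSet n)) λ L → Unique L × length L ≡ c × (∀ E → (E ∈ L) ⇔ P E)

{-# OPTIONS --safe #-}
-- Splice H into an r-regular graph A at an edge xy: delete xy, add a disjoint copy of H
-- and join x to u and y to v. Degrees are preserved because u and v lack exactly one
-- edge each. A hamiltonian cycle of the spliced graph must use both joining edges, so
-- it consists of a hamiltonian path of A from y to x (a hamiltonian cycle of A through
-- xy with xy removed) followed by a hamiltonian uv-path of H. This bijection multiplies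
-- the counts: c cycles through xy give c c₂ hamiltonian cycles, and c c₃ of them pass
-- through the copy of x′y′. Splicing k − 1 times at the newest copy of x′y′, starting
-- from G and xy, and once more at the end yields c₁ c₃^(k−1) c₂ hamiltonian cycles.
module Submission where

open import Defs hiding (sym)
open import Data.Nat as ℕ using (ℕ; zero; suc; _+_; _*_; _∸_; _^_; _≤_; _<_; z≤n; s≤s)
import Data.Nat.Properties as ℕₚ
open import Data.Fin as Fin using (Fin; toℕ; fromℕ<; fromℕ; inject₁; opposite; _↑ˡ_; _↑ʳ_; splitAt)
import Data.Fin.Properties as Finₚ
open import Data.Fin.Properties using (toℕ-injective; toℕ-fromℕ<; toℕ<n; toℕ-↑ˡ; toℕ-↑ʳ)
open import Data.Bool using (Bool; true; false; _∧_; _∨_; not; if_then_else_)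
import Data.Bool.Properties as Boolₚ
open import Data.List using (List; []; _∷_; length; map; filterᵇ; allFin; tabulate; cartesianProduct)
import Data.List.Properties as Listₚ
open import Data.List.Membership.Propositional using (_∈_)
import Data.List.Membership.Propositional.Properties as ∈ₚ
open import Data.List.Relation.Unary.Any using (here; there)
open import Data.List.Relation.Unary.All using (All; []; _∷_)
open import Data.List.Relation.Unary.AllPairs using ([]; _∷_)
open import Data.List.Relation.Unary.Unique.Propositional using (Unique)
import Data.List.Relation.Unary.Unique.Propositional.Properties as Uniqueₚ
import Data.Vec as Vec
import Data.Vec.Properties as Vecₚ
open import Data.Product using (Σ; ∃; ∃-syntax; _×_; _,_; proj₁; proj₂; uncurry)
open import Data.Sum as Sum using (_⊎_; inj₁; inj₂; [_,_]′)
open import Data.Empty using (⊥; ⊥-elim)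
open import Relation.Nullary using (Dec; yes; no; isYes)
open import Relation.Binary.PropositionalEquality
open import Function.Definitions using (Bijective)
open import Function.Bundles using (_⇔_; mk⇔; Equivalence)
open import Function.Consequences.Propositional using (strictlySurjective⇒surjective)

Adj-sym : ∀ {n} (G : Graph n) {i j} → Adj G i j → Adj G j i
Adj-sym G {i} {j} e = trans (Graph.sym G j i) e

Adj⇒≢ : ∀ {n} (G : Graph n) {i j} → Adj G i j → i ≢ j
Adj⇒≢ G {i} e refl with trans (sym (irref G i)) e
... | ()

true≢false : true ≢ false
true≢false ()

mkBijective : ∀ {n} {f : Fin n → Fin n} →
  (∀ {a b} → f a ≡ f b → a ≡ b) → (∀ y → ∃ λ x → f x ≡ y) → Bijective _≡_ _≡_ f
mkBijective inj sur = inj , strictlySurjective⇒surjective sur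

preimage : ∀ {n} {f : Fin n → Fin n} → Bijective _≡_ _≡_ f → ∀ y → ∃ λ x → f x ≡ y
preimage (_ , sur) y = proj₁ (sur y) , proj₂ (sur y) refl

↑-elim : ∀ m {n} (P : Fin (m + n) → Set) →
  (∀ a → P (a ↑ˡ n)) → (∀ h → P (m ↑ʳ h)) → ∀ i → P i
↑-elim m {n} P left right i with splitAt m i in eq
... | inj₁ a = subst P (Finₚ.splitAt⁻¹-↑ˡ eq) (left a)
... | inj₂ h = subst P (Finₚ.splitAt⁻¹-↑ʳ eq) (right h)

↑ˡ≢↑ʳ : ∀ {m n} (a : Fin m) (h : Fin n) → a ↑ˡ n ≢ m ↑ʳ h
↑ˡ≢↑ʳ {m} {n} a h e = ℕₚ.<⇒≱ (toℕ<n a) (begin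
    m              ≤⟨ ℕₚ.m≤m+n m (toℕ h) ⟩
    m + toℕ h      ≡⟨ sym (toℕ-↑ʳ m h) ⟩
    toℕ (m ↑ʳ h)   ≡⟨ cong toℕ (sym e) ⟩
    toℕ (a ↑ˡ n)   ≡⟨ toℕ-↑ˡ a n ⟩
    toℕ a          ∎)
  where open ℕₚ.≤-Reasoning

_≡ᵇ_ : ∀ {n} → Fin n → Fin n → Bool
a ≡ᵇ b = isYes (a Fin.≟ b)

≡ᵇ-refl : ∀ {n} (a : Fin n) → (a ≡ᵇ a) ≡ true
≡ᵇ-refl a with a Fin.≟ a
... | yes _ = refl
... | no a≢a = ⊥-elim (a≢a refl)

≢⇒≡ᵇ-false : ∀ {n} {a b : Fin n} → a ≢ b → (a ≡ᵇ b) ≡ false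
≢⇒≡ᵇ-false {a = a} {b} a≢b with a Fin.≟ b
... | yes a≡b = ⊥-elim (a≢b a≡b)
... | no _ = refl

≡ᵇ-true⇒≡ : ∀ {n} {a b : Fin n} → (a ≡ᵇ b) ≡ true → a ≡ b
≡ᵇ-true⇒≡ {a = a} {b} t with a Fin.≟ b
... | yes a≡b = a≡b

≡-fromℕ< : ∀ {n a} {i : Fin n} (a<n : a < n) → toℕ i ≡ a → i ≡ fromℕ< a<n
≡-fromℕ< a<n e = toℕ-injective (trans e (sym (toℕ-fromℕ< a<n)))

firstPosition : ∀ {k} → 1 ≤ k → Σ (Fin k) λ a → toℕ a ≡ 0
firstPosition {suc k} _ = Fin.zero , refl

lastPosition : ∀ {k} → 1 ≤ k → Σ (Fin k) λ a → suc (toℕ a) ≡ k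
lastPosition {suc k} _ = fromℕ k , cong suc (Finₚ.toℕ-fromℕ k)

-- Counting

count : ∀ {n} → (Fin n → Bool) → ℕ
count {zero} f = 0
count {suc n} f = (if f Fin.zero then 1 else 0) + count (λ i → f (Fin.suc i))

length-filterᵇ-allFin : ∀ {n} (f : Fin n → Bool) → length (filterᵇ f (allFin n)) ≡ count f
length-filterᵇ-allFin {n} f = go n (λ i → i)
  where
  go : ∀ k (g : Fin k → Fin n) → length (filterᵇ f (tabulate g)) ≡ count (λ i → f (g i))
  go zero g = refl
  go (suc k) g with f (g Fin.zero)
  ... | true = cong suc (go k (λ i → g (Fin.suc i)))
  ... | false = go k (λ i → g (Fin.suc i))

deg≡count : ∀ {n} (G : Graph n) i → deg G i ≡ count (adj G i)
deg≡count G i = length-filterᵇ-allFin (adj G i)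

count-cong : ∀ {n} {f g : Fin n → Bool} → (∀ i → f i ≡ g i) → count f ≡ count g
count-cong {zero} e = refl
count-cong {suc n} e =
  cong₂ (λ b k → (if b then 1 else 0) + k) (e Fin.zero) (count-cong (λ i → e (Fin.suc i)))

count-↑ : ∀ m {n} (f : Fin (m + n) → Bool) →
  count f ≡ count (λ a → f (a ↑ˡ n)) + count (λ h → f (m ↑ʳ h))
count-↑ zero f = refl
count-↑ (suc m) f =
  trans (cong ((if f Fin.zero then 1 else 0) +_) (count-↑ m (λ i → f (Fin.suc i))))
        (sym (ℕₚ.+-assoc (if f Fin.zero then 1 else 0) _ _))

count-none : ∀ {n} (f : Fin n → Bool) → (∀ i → f i ≡ false) → count f ≡ 0
count-none {zero} f none = refl
count-none {suc n} f none rewrite none Fin.zero =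
  count-none (λ i → f (Fin.suc i)) (λ i → none (Fin.suc i))

count-single : ∀ {n} (f : Fin n → Bool) (i : Fin n) →
  f i ≡ true → (∀ j → j ≢ i → f j ≡ false) → count f ≡ 1
count-single {suc n} f Fin.zero fi others rewrite fi =
  cong suc (count-none _ (λ j → others (Fin.suc j) (λ ())))
count-single {suc n} f (Fin.suc i) fi others rewrite others Fin.zero (λ ()) =
  count-single (λ j → f (Fin.suc j)) i fi
    (λ j j≢i → others (Fin.suc j) (λ e → j≢i (Finₚ.suc-injective e)))

count-remove : ∀ {n} (f g : Fin n → Bool) (i : Fin n) →
  (∀ j → j ≢ i → f j ≡ g j) → f i ≡ true → g i ≡ false → count f ≡ suc (count g)
count-remove {suc n} f g Fin.zero others fi gi rewrite fi | gi =
  cong suc (count-cong (λ j → others (Fin.suc j) (λ ())))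
count-remove {suc n} f g (Fin.suc i) others fi gi rewrite others Fin.zero (λ ()) =
  trans (cong ((if g Fin.zero then 1 else 0) +_)
          (count-remove (λ j → f (Fin.suc j)) (λ j → g (Fin.suc j)) i
            (λ j j≢i → others (Fin.suc j) (λ e → j≢i (Finₚ.suc-injective e))) fi gi))
        (ℕₚ.+-suc (if g Fin.zero then 1 else 0) _)

count≤n : ∀ {n} (f : Fin n → Bool) → count f ≤ n
count≤n {zero} f = z≤n
count≤n {suc n} f with f Fin.zero
... | true = s≤s (count≤n (λ i → f (Fin.suc i)))
... | false = ℕₚ.m≤n⇒m≤1+n (count≤n (λ i → f (Fin.suc i)))

count<n : ∀ {n} (f : Fin n → Bool) (i : Fin n) → f i ≡ false → count f < n
count<n {suc n} f Fin.zero fi rewrite fi = s≤s (count≤n (λ i → f (Fin.suc i)))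
count<n {suc n} f (Fin.suc i) fi with f Fin.zero
... | true = s≤s (count<n (λ i → f (Fin.suc i)) i fi)
... | false = ℕₚ.m≤n⇒m≤1+n (count<n (λ i → f (Fin.suc i)) i fi)

unique-map : ∀ {A B : Set} (f : A → B) {xs : List A} →
  (∀ {z z′} → z ∈ xs → z′ ∈ xs → f z ≡ f z′ → z ≡ z′) → Unique xs → Unique (map f xs)
unique-map f {[]} inj [] = []
unique-map f {x ∷ xs} inj (x∉xs ∷ u) =
  distinct (λ z → z) x∉xs ∷ unique-map f (λ z z′ → inj (there z) (there z′)) u
  where
  distinct : ∀ {ys} → (∀ {z} → z ∈ ys → z ∈ xs) →
    All (λ z → x ≢ z) ys → All (λ z → f x ≢ z) (map f ys)
  distinct sub [] = []
  distinct sub (x≢z ∷ r) =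
    (λ e → x≢z (inj (here refl) (there (sub (here refl))) e)) ∷ distinct (λ z → sub (there z)) r

length-cartesianProduct : ∀ {A B : Set} (xs : List A) (ys : List B) →
  length (cartesianProduct xs ys) ≡ length xs * length ys
length-cartesianProduct [] ys = refl
length-cartesianProduct (x ∷ xs) ys =
  trans (Listₚ.length-++ (map (x ,_) ys))
        (cong₂ _+_ (Listₚ.length-map (x ,_) ys) (length-cartesianProduct xs ys))

HasExactly-cong : ∀ {n c} {P Q : EdgeSet n → Set} →
  (∀ E → P E ⇔ Q E) → HasExactly c P → HasExactly c Q
HasExactly-cong P⇔Q (L , u , l , mem) = L , u , l , λ E →
  mk⇔ (λ z → Equivalence.to (P⇔Q E) (Equivalence.to (mem E) z))
      (λ z → Equivalence.from (mem E) (Equivalence.from (P⇔Q E) z))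

HasExactly-* : ∀ {m n k c d} {P : EdgeSet m → Set} {R : EdgeSet n → Set} {Q : EdgeSet k → Set}
  (F : EdgeSet m → EdgeSet n → EdgeSet k) →
  (∀ {a a′ h h′} → P a → P a′ → R h → R h′ → F a h ≡ F a′ h′ → a ≡ a′ × h ≡ h′) →
  (∀ {a h} → P a → R h → Q (F a h)) →
  (∀ {E} → Q E → ∃ λ a → ∃ λ h → P a × R h × E ≡ F a h) →
  HasExactly c P → HasExactly d R → HasExactly (c * d) Q
HasExactly-* {k = k} {c} {d} {P} {R} {Q} F inj sound complete (LP , uP , lP , memP) (LR , uR , lR , memR) =
  L , unique-map (uncurry F) injL (Uniqueₚ.cartesianProduct⁺ uP uR) , lengthL , memL
  where
  L : List (EdgeSet k)
  L = map (uncurry F) (cartesianProduct LP LR)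
  injL : ∀ {z z′} → z ∈ cartesianProduct LP LR → z′ ∈ cartesianProduct LP LR →
    uncurry F z ≡ uncurry F z′ → z ≡ z′
  injL {a , h} {a′ , h′} i i′ e with ∈ₚ.∈-cartesianProduct⁻ LP LR i | ∈ₚ.∈-cartesianProduct⁻ LP LR i′
  ... | ia , ih | ia′ , ih′
    with inj (Equivalence.to (memP a) ia) (Equivalence.to (memP a′) ia′)
             (Equivalence.to (memR h) ih) (Equivalence.to (memR h′) ih′) e
  ... | refl , refl = refl
  lengthL : length L ≡ c * d
  lengthL = trans (Listₚ.length-map (uncurry F) (cartesianProduct LP LR))
                  (trans (length-cartesianProduct LP LR) (cong₂ _*_ lP lR))
  memL : ∀ E → (E ∈ L) ⇔ Q E
  memL E = mk⇔ to from
    where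
    to : E ∈ L → Q E
    to i with ∈ₚ.∈-map⁻ (uncurry F) i
    ... | (a , h) , iz , refl with ∈ₚ.∈-cartesianProduct⁻ LP LR iz
    ... | ia , ih = sound (Equivalence.to (memP a) ia) (Equivalence.to (memR h) ih)
    from : Q E → E ∈ L
    from qE with complete qE
    ... | a , h , pa , rh , refl =
      ∈ₚ.∈-map⁺ (uncurry F) (∈ₚ.∈-cartesianProduct⁺ (Equivalence.from (memP a) pa) (Equivalence.from (memR h) rh))

entry : ∀ {n} → EdgeSet n → Fin n → Fin n → Bool
entry E i j = Vec.lookup (Vec.lookup E i) j

fromEntries : ∀ {n} → (Fin n → Fin n → Bool) → EdgeSet n
fromEntries f = Vec.tabulate (λ i → Vec.tabulate (f i))

entry-fromEntries : ∀ {n} (f : Fin n → Fin n → Bool) i j → entry (fromEntries f) i j ≡ f i j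
entry-fromEntries f i j =
  trans (cong (λ row → Vec.lookup row j) (Vecₚ.lookup∘tabulate _ i)) (Vecₚ.lookup∘tabulate _ j)

≡-fromEntries : ∀ {n} (E : EdgeSet n) (f : Fin n → Fin n → Bool) →
  (∀ i j → entry E i j ≡ f i j) → E ≡ fromEntries f
≡-fromEntries E f e = trans (sym (Vecₚ.tabulate∘lookup E))
  (Vecₚ.tabulate-cong (λ i → trans (sym (Vecₚ.tabulate∘lookup (Vec.lookup E i))) (Vecₚ.tabulate-cong (e i))))

Bool-≡-⇔ : ∀ {b c : Bool} → (b ≡ true → c ≡ true) → (c ≡ true → b ≡ true) → b ≡ c
Bool-≡-⇔ {true} {true} f g = refl
Bool-≡-⇔ {true} {false} f g = sym (f refl)
Bool-≡-⇔ {false} {true} f g = g refl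
Bool-≡-⇔ {false} {false} f g = refl

∧-true : ∀ {b c} → b ∧ c ≡ true → b ≡ true × c ≡ true
∧-true {true} {true} _ = refl , refl

not-true : ∀ {b} → not b ≡ true → b ≡ false
not-true {false} _ = refl

≡true-⇔ : ∀ {b c : Bool} {P : Set} → b ≡ c → (c ≡ true → P) → (P → c ≡ true) → (b ≡ true) ⇔ P
≡true-⇔ refl f g = mk⇔ f g

Consecutive : ∀ {n k} → (Fin k → Fin k → Set) → (Fin k → Fin n) → Fin n → Fin n → Set
Consecutive Next p i j = ∃[ a ] ∃[ b ] (Next a b × ((p a ≡ i × p b ≡ j) ⊎ (p a ≡ j × p b ≡ i)))

Consecutive-sym : ∀ {n k} {Next : Fin k → Fin k → Set} {p : Fin k → Fin n} {i j} →
  Consecutive Next p i j → Consecutive Next p j i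
Consecutive-sym (a , b , next , inj₁ e) = a , b , next , inj₂ e
Consecutive-sym (a , b , next , inj₂ e) = a , b , next , inj₁ e

-- Hamiltonian cycles as orderings of positions

HamCycleOrder : ∀ {n} → Graph n → EdgeSet n → (Fin n → Fin n) → Set
HamCycleOrder G E p =
  Bijective _≡_ _≡_ p × (∀ a b → CycNext a b → Adj G (p a) (p b)) × EdgesOf CycNext p E

HamCycleOrder-cong : ∀ {n} {G : Graph n} {E} {p q : Fin n → Fin n} →
  (∀ c → p c ≡ q c) → HamCycleOrder G E p → HamCycleOrder G E q
HamCycleOrder-cong {n} {G} {E} {p} {q} p≗q ((inj , sur) , adjacent , edges) = bij , adjacent′ , edges′
  where
  bij : Bijective _≡_ _≡_ q
  bij = mkBijective (λ {a} {b} e → inj (trans (p≗q a) (trans e (sym (p≗q b)))))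
    (λ w → let (c , e) = preimage (inj , sur) w in c , trans (sym (p≗q c)) e)
  adjacent′ : ∀ a b → CycNext a b → Adj G (q a) (q b)
  adjacent′ a b next = subst₂ (Adj G) (p≗q a) (p≗q b) (adjacent a b next)
  transport : ∀ {f g : Fin n → Fin n} → (∀ c → f c ≡ g c) → ∀ {i j} →
    Consecutive CycNext f i j → Consecutive CycNext g i j
  transport f≗g (a , b , next , inj₁ (e₁ , e₂)) = a , b , next , inj₁ (trans (sym (f≗g a)) e₁ , trans (sym (f≗g b)) e₂)
  transport f≗g (a , b , next , inj₂ (e₁ , e₂)) = a , b , next , inj₂ (trans (sym (f≗g a)) e₁ , trans (sym (f≗g b)) e₂)
  edges′ : EdgesOf CycNext q E
  edges′ i j = mk⇔ (λ t → transport p≗q (Equivalence.to (edges i j) t))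
                   (λ c → Equivalence.from (edges i j) (transport (λ c → sym (p≗q c)) c))

IsHamCycle-sym : ∀ {n} {G : Graph n} {E i j} → IsHamCycle G E → E ∋ₑ i , j → E ∋ₑ j , i
IsHamCycle-sym {i = i} {j} (_ , _ , _ , _ , edges) e =
  Equivalence.from (edges j i) (Consecutive-sym (Equivalence.to (edges i j) e))

HamCycleOrder-reindex : ∀ {n} {G : Graph n} {E} {p} (σ τ : Fin n → Fin n) →
  (∀ i → σ (τ i) ≡ i) → (∀ i → τ (σ i) ≡ i) →
  (∀ a b → CycNext a b → CycNext (σ a) (σ b) ⊎ CycNext (σ b) (σ a)) →
  (∀ a b → CycNext a b → CycNext (τ a) (τ b) ⊎ CycNext (τ b) (τ a)) →
  HamCycleOrder G E p → HamCycleOrder G E (λ i → p (σ i))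
HamCycleOrder-reindex {G = G} {E} {p} σ τ στ τσ σ-next τ-next ((inj , sur) , adjacent , edges) =
  bij , adjacent′ , edges′
  where
  bij : Bijective _≡_ _≡_ (λ i → p (σ i))
  bij = mkBijective (λ e → trans (sym (τσ _)) (trans (cong τ (inj e)) (τσ _)))
    (λ w → let (c , e) = preimage (inj , sur) w in τ c , trans (cong p (στ c)) e)
  adjacent′ : ∀ a b → CycNext a b → Adj G (p (σ a)) (p (σ b))
  adjacent′ a b next with σ-next a b next
  ... | inj₁ next′ = adjacent _ _ next′
  ... | inj₂ next′ = Adj-sym G (adjacent _ _ next′)
  back : ∀ {a b i j} → (p a ≡ i × p b ≡ j) → (p (σ (τ a)) ≡ i × p (σ (τ b)) ≡ j)
  back {a} {b} (e₁ , e₂) = trans (cong p (στ a)) e₁ , trans (cong p (στ b)) e₂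
  edges′ : EdgesOf CycNext (λ i → p (σ i)) E
  edges′ i j = mk⇔ to from
    where
    to : E ∋ₑ i , j → Consecutive CycNext (λ i → p (σ i)) i j
    to e with Equivalence.to (edges i j) e
    ... | a , b , next , pair with τ-next a b next
    ... | inj₁ next′ = τ a , τ b , next′ , Sum.map back back pair
    ... | inj₂ next′ = τ b , τ a , next′ , Sum.map (λ (e₁ , e₂) → back (e₂ , e₁)) (λ (e₁ , e₂) → back (e₂ , e₁)) (Sum.swap pair)
    from : Consecutive CycNext (λ i → p (σ i)) i j → E ∋ₑ i , j
    from (a , b , next , pair) with σ-next a b next
    ... | inj₁ next′ = Equivalence.from (edges i j) (σ a , σ b , next′ , pair)
    ... | inj₂ next′ = Equivalence.from (edges i j)
      (σ b , σ a , next′ , Sum.swap (Sum.map (λ (e₁ , e₂) → e₂ , e₁) (λ (e₁ , e₂) → e₂ , e₁) pair))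

rotate : ∀ {n} → Fin n → Fin n
rotate {suc n} i with suc (toℕ i) ℕ.<? suc n
... | yes i+1<n = fromℕ< i+1<n
... | no _ = Fin.zero

toℕ-rotate : ∀ {n} (i : Fin n) →
  (suc (toℕ i) < n × toℕ (rotate i) ≡ suc (toℕ i)) ⊎ (suc (toℕ i) ≡ n × toℕ (rotate i) ≡ 0)
toℕ-rotate {suc n} i with suc (toℕ i) ℕ.<? suc n
... | yes i+1<n = inj₁ (i+1<n , toℕ-fromℕ< i+1<n)
... | no i+1≮n = inj₂ (ℕₚ.≤-antisym (toℕ<n i) (ℕₚ.≮⇒≥ i+1≮n) , refl)

CycNext-rotate : ∀ {n} (a : Fin n) → CycNext a (rotate a)
CycNext-rotate a with toℕ-rotate a
... | inj₁ (_ , e) = inj₁ e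
... | inj₂ e = inj₂ e

CycNext⇒≡rotate : ∀ {n} {a b : Fin n} → CycNext a b → b ≡ rotate a
CycNext⇒≡rotate {a = a} {b} next with toℕ-rotate a | next
... | inj₁ (_ , e) | inj₁ e′ = toℕ-injective (trans e′ (sym e))
... | inj₁ (a+1<n , _) | inj₂ (a+1≡n , _) = ⊥-elim (ℕₚ.<-irrefl a+1≡n a+1<n)
... | inj₂ (a+1≡n , _) | inj₁ e′ = ⊥-elim (ℕₚ.<-irrefl (trans e′ a+1≡n) (toℕ<n b))
... | inj₂ (_ , e) | inj₂ (_ , e′) = toℕ-injective (trans e′ (sym e))

rotate-injective : ∀ {n} {a b : Fin n} → rotate a ≡ rotate b → a ≡ b
rotate-injective {a = a} {b} e with toℕ-rotate a | toℕ-rotate b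
... | inj₁ (_ , ea) | inj₁ (_ , eb) = toℕ-injective (ℕₚ.suc-injective (trans (sym ea) (trans (cong toℕ e) eb)))
... | inj₁ (_ , ea) | inj₂ (_ , eb) = ⊥-elim (ℕₚ.0≢1+n (trans (sym eb) (trans (cong toℕ (sym e)) ea)))
... | inj₂ (_ , ea) | inj₁ (_ , eb) = ⊥-elim (ℕₚ.0≢1+n (trans (sym ea) (trans (cong toℕ e) eb)))
... | inj₂ (ea , _) | inj₂ (eb , _) = toℕ-injective (ℕₚ.suc-injective (trans ea (sym eb)))

unrotate : ∀ {n} → Fin n → Fin n
unrotate {suc n} Fin.zero = fromℕ n
unrotate {suc n} (Fin.suc i) = inject₁ i

rotate-unrotate : ∀ {n} (i : Fin n) → rotate (unrotate i) ≡ i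
rotate-unrotate {suc n} Fin.zero with toℕ-rotate (fromℕ n)
... | inj₁ (n+1<n+1 , _) = ⊥-elim (ℕₚ.<-irrefl (cong suc (Finₚ.toℕ-fromℕ n)) n+1<n+1)
... | inj₂ (_ , e) = toℕ-injective e
rotate-unrotate {suc n} (Fin.suc i) with toℕ-rotate (inject₁ i)
... | inj₁ (_ , e) = toℕ-injective (trans e (cong suc (Finₚ.toℕ-inject₁ i)))
... | inj₂ (e , _) =
  ⊥-elim (ℕₚ.<-irrefl (trans (cong suc (sym (Finₚ.toℕ-inject₁ i))) e) (toℕ<n (Fin.suc i)))

unrotate-rotate : ∀ {n} (i : Fin n) → unrotate (rotate i) ≡ i
unrotate-rotate i = rotate-injective (rotate-unrotate (rotate i))

HamCycleOrder-rotate : ∀ {n} {G : Graph n} {E p} →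
  HamCycleOrder G E p → HamCycleOrder G E (λ i → p (rotate i))
HamCycleOrder-rotate {G = G} {E} {p} = HamCycleOrder-reindex {G = G} {E} {p} rotate unrotate rotate-unrotate unrotate-rotate
  (λ a b next → inj₁ (subst (λ c → CycNext (rotate a) (rotate c)) (sym (CycNext⇒≡rotate next))
                            (CycNext-rotate (rotate a))))
  (λ a b next → inj₁ (subst (CycNext (unrotate a))
    (sym (trans (cong unrotate (CycNext⇒≡rotate next)) (trans (unrotate-rotate a) (sym (rotate-unrotate a)))))
    (CycNext-rotate (unrotate a))))

toℕ-opposite+suc : ∀ {n} (i : Fin n) → toℕ (opposite i) + suc (toℕ i) ≡ n
toℕ-opposite+suc i = trans (cong (_+ suc (toℕ i)) (Finₚ.opposite-prop i)) (ℕₚ.m∸n+n≡m (toℕ<n i))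

CycNext-opposite : ∀ {n} (a b : Fin n) → CycNext a b → CycNext (opposite b) (opposite a)
CycNext-opposite {n} a b (inj₁ b≡a+1) = inj₁ (ℕₚ.+-cancelʳ-≡ (suc (toℕ a)) _ _ (begin
  toℕ (opposite a) + suc (toℕ a)         ≡⟨ toℕ-opposite+suc a ⟩
  n                                      ≡⟨ sym (toℕ-opposite+suc b) ⟩
  toℕ (opposite b) + suc (toℕ b)         ≡⟨ cong (λ k → toℕ (opposite b) + suc k) b≡a+1 ⟩
  toℕ (opposite b) + suc (suc (toℕ a))   ≡⟨ ℕₚ.+-suc (toℕ (opposite b)) (suc (toℕ a)) ⟩
  suc (toℕ (opposite b)) + suc (toℕ a)   ∎))
  where open ≡-Reasoning
CycNext-opposite {n} a b (inj₂ (a+1≡n , b≡0)) = inj₂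
  ( trans (trans (ℕₚ.+-comm 1 (toℕ (opposite b))) (cong (λ k → toℕ (opposite b) + suc k) (sym b≡0)))
          (toℕ-opposite+suc b)
  , ℕₚ.+-cancelʳ-≡ n _ _ (trans (cong (toℕ (opposite a) +_) (sym a+1≡n)) (toℕ-opposite+suc a)))

HamCycleOrder-opposite : ∀ {n} {G : Graph n} {E p} →
  HamCycleOrder G E p → HamCycleOrder G E (λ i → p (opposite i))
HamCycleOrder-opposite {G = G} {E} {p} = HamCycleOrder-reindex {G = G} {E} {p} opposite opposite
  Finₚ.opposite-involutive Finₚ.opposite-involutive
  (λ a b next → inj₂ (CycNext-opposite a b next)) (λ a b next → inj₂ (CycNext-opposite a b next))

HamCycleOrder-startAt : ∀ {n} {G : Graph n} {E p} → HamCycleOrder G E p → (w : Fin n) →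
  ∃ λ q → HamCycleOrder G E q × (∀ a → toℕ a ≡ 0 → q a ≡ w)
HamCycleOrder-startAt {n} {G} {E} {p} hp w = go (toℕ c) p hp c refl pc≡w
  where
  c : Fin n
  c = proj₁ (preimage (proj₁ hp) w)
  pc≡w : p c ≡ w
  pc≡w = proj₂ (preimage (proj₁ hp) w)
  go : ∀ k p → HamCycleOrder G E p → ∀ c → toℕ c ≡ k → p c ≡ w →
    ∃ λ q → HamCycleOrder G E q × (∀ a → toℕ a ≡ 0 → q a ≡ w)
  go zero p hp c c≡0 pc≡w = p , hp , λ a a≡0 → trans (cong p (toℕ-injective (trans a≡0 (sym c≡0)))) pc≡w
  go (suc k) p hp (Fin.suc i) i+1≡k+1 pc≡w =
    go k (λ i → p (rotate i)) (HamCycleOrder-rotate {G = G} {E} {p} hp) (unrotate (Fin.suc i))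
       (trans (Finₚ.toℕ-inject₁ i) (ℕₚ.suc-injective i+1≡k+1))
       (trans (cong p (rotate-unrotate (Fin.suc i))) pc≡w)

-- The reflection of positions fixing 0, i.e. a ↦ -a mod n.
reflect : ∀ {n} → Fin n → Fin n
reflect i = rotate (opposite i)

HamCycleOrder-reflect : ∀ {n} {G : Graph n} {E p} →
  HamCycleOrder G E p → HamCycleOrder G E (λ i → p (reflect i))
HamCycleOrder-reflect {G = G} {E} {p} hp =
  HamCycleOrder-opposite {G = G} {E} (HamCycleOrder-rotate {G = G} {E} {p} hp)

toℕ-reflect-zero : ∀ {n} (a : Fin n) → toℕ a ≡ 0 → toℕ (reflect a) ≡ 0
toℕ-reflect-zero {n} a a≡0 with toℕ-rotate (opposite a)
... | inj₂ (_ , e) = e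
... | inj₁ (lt , _) = ⊥-elim (ℕₚ.<-irrefl (begin
  suc (toℕ (opposite a))          ≡⟨ ℕₚ.+-comm 1 (toℕ (opposite a)) ⟩
  toℕ (opposite a) + 1            ≡⟨ cong (λ k → toℕ (opposite a) + suc k) (sym a≡0) ⟩
  toℕ (opposite a) + suc (toℕ a)  ≡⟨ toℕ-opposite+suc a ⟩
  n                               ∎) lt)
  where open ≡-Reasoning

toℕ-reflect+toℕ : ∀ {n} (a : Fin n) → toℕ a ≢ 0 → toℕ (reflect a) + toℕ a ≡ n
toℕ-reflect+toℕ {n} a a≢0 with toℕ-rotate (opposite a)
... | inj₁ (_ , e) = trans (cong (_+ toℕ a) e)
  (trans (sym (ℕₚ.+-suc (toℕ (opposite a)) (toℕ a))) (toℕ-opposite+suc a))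
... | inj₂ (e , _) = ⊥-elim (a≢0 (ℕₚ.+-cancelˡ-≡ n _ _ (begin
  n + toℕ a                          ≡⟨ cong (_+ toℕ a) (sym e) ⟩
  suc (toℕ (opposite a)) + toℕ a     ≡⟨ sym (ℕₚ.+-suc (toℕ (opposite a)) (toℕ a)) ⟩
  toℕ (opposite a) + suc (toℕ a)     ≡⟨ toℕ-opposite+suc a ⟩
  n                                  ≡⟨ sym (ℕₚ.+-identityʳ n) ⟩
  n + 0                              ∎)))
  where open ≡-Reasoning

module _ {n} {G : Graph n} {E : EdgeSet n} (n≥3 : 3 ≤ n) where

  private
    first : Fin n
    first = fromℕ< (ℕₚ.≤-trans (s≤s z≤n) n≥3)

    second : Fin n
    second = fromℕ< (ℕₚ.≤-trans (s≤s (s≤s z≤n)) n≥3)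

    n≢1 : n ≢ 1
    n≢1 e = ℕₚ.<-irrefl (sym e) (ℕₚ.≤-<-trans (s≤s z≤n) n≥3)

    n≢2 : n ≢ 2
    n≢2 e = ℕₚ.<-irrefl (sym e) (ℕₚ.≤-<-trans (s≤s (s≤s z≤n)) n≥3)

    at-first : ∀ {q} → HamCycleOrder G E q → ∀ {w} → (∀ a → toℕ a ≡ 0 → q a ≡ w) →
      ∀ {c} → q c ≡ w → toℕ c ≡ 0
    at-first hq q0 e =
      trans (cong toℕ (proj₁ (proj₁ hq) (trans e (sym (q0 first (toℕ-fromℕ< _)))))) (toℕ-fromℕ< _)

    toℕ-reflect-last : ∀ c → suc (toℕ c) ≡ n → toℕ (reflect c) ≡ 1
    toℕ-reflect-last c c+1≡n = ℕₚ.+-cancelʳ-≡ (toℕ c) _ _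
      (trans (toℕ-reflect+toℕ c (λ c≡0 → n≢1 (trans (sym c+1≡n) (cong suc c≡0)))) (sym c+1≡n))

    toℕ-reflect-second : ∀ c → toℕ c ≡ 1 → suc (toℕ (reflect c)) ≡ n
    toℕ-reflect-second c c≡1 = trans (ℕₚ.+-comm 1 _)
      (trans (cong (toℕ (reflect c) +_) (sym c≡1))
             (toℕ-reflect+toℕ c (λ c≡0 → ℕₚ.0≢1+n (trans (sym c≡0) c≡1))))

  HamCycleOrder-fromTo : ∀ {p} (x y : Fin n) → HamCycleOrder G E p → E ∋ₑ x , y →
    ∃ λ q → HamCycleOrder G E q × (∀ a → toℕ a ≡ 0 → q a ≡ y) × (∀ a → suc (toℕ a) ≡ n → q a ≡ x)
  HamCycleOrder-fromTo {p} x y hp xy with HamCycleOrder-startAt {G = G} {E} {p} hp y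
  ... | q , hq , q0 with Equivalence.to (proj₂ (proj₂ hq) x y) xy
  ... | a , b , next , inj₁ (qa , qb) = q , hq , q0 , q-last
    where
    last : CycNext a b → suc (toℕ a) ≡ n
    last (inj₁ b≡a+1) = ⊥-elim (ℕₚ.0≢1+n (trans (sym (at-first hq q0 qb)) b≡a+1))
    last (inj₂ (a+1≡n , _)) = a+1≡n
    q-last : ∀ c → suc (toℕ c) ≡ n → q c ≡ x
    q-last c c+1≡n = trans (cong q (toℕ-injective (ℕₚ.suc-injective (trans c+1≡n (sym (last next)))))) qa
  ... | a , b , next , inj₂ (qa , qb) =
    (λ i → q (reflect i)) , HamCycleOrder-reflect {G = G} {E} {q} hq ,
    (λ c c≡0 → q0 (reflect c) (toℕ-reflect-zero c c≡0)) , q-last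
    where
    second-position : CycNext a b → toℕ b ≡ 1
    second-position (inj₁ b≡a+1) = trans b≡a+1 (cong suc (at-first hq q0 qa))
    second-position (inj₂ (a+1≡n , _)) = ⊥-elim (n≢1 (trans (sym a+1≡n) (cong suc (at-first hq q0 qa))))
    q-last : ∀ c → suc (toℕ c) ≡ n → q (reflect c) ≡ x
    q-last c c+1≡n = trans (cong q (toℕ-injective (trans (toℕ-reflect-last c c+1≡n) (sym (second-position next))))) qb

  HamCycleOrder-startAt-avoiding : ∀ {p} (w z : Fin n) → HamCycleOrder G E p →
    ∃ λ q → HamCycleOrder G E q × (∀ c → toℕ c ≡ 0 → q c ≡ w) × (∀ c → toℕ c ≡ 1 → q c ≢ z)
  HamCycleOrder-startAt-avoiding {p} w z hp with HamCycleOrder-startAt {G = G} {E} {p} hp w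
  ... | q , hq , q0 with q second Fin.≟ z
  ... | no q₁≢z = q , hq , q0 ,
    λ c c≡1 → subst (λ c → q c ≢ z) (toℕ-injective (trans (toℕ-fromℕ< _) (sym c≡1))) q₁≢z
  ... | yes q₁≡z = (λ i → q (reflect i)) , HamCycleOrder-reflect {G = G} {E} {q} hq ,
    (λ c c≡0 → q0 (reflect c) (toℕ-reflect-zero c c≡0)) , q-second
    where
    q-second : ∀ c → toℕ c ≡ 1 → q (reflect c) ≢ z
    q-second c c≡1 e = n≢2 (trans (sym (toℕ-reflect-second c c≡1))
      (cong suc (trans (cong toℕ (proj₁ (proj₁ hq) (trans e (sym q₁≡z)))) (toℕ-fromℕ< _))))

-- The spliced graph

module Splice {m n : ℕ} (A : Graph m) (x y : Fin m) (H : Graph n) (u v : Fin n) where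

  link : Fin m → Fin n → Bool
  link a h = (a ≡ᵇ x ∧ h ≡ᵇ u) ∨ (a ≡ᵇ y ∧ h ≡ᵇ v)

  isXY : Fin m → Fin m → Bool
  isXY a b = (a ≡ᵇ x ∧ b ≡ᵇ y) ∨ (a ≡ᵇ y ∧ b ≡ᵇ x)

  isXY-sym : ∀ a b → isXY a b ≡ isXY b a
  isXY-sym a b = trans (Boolₚ.∨-comm (a ≡ᵇ x ∧ b ≡ᵇ y) _)
    (cong₂ _∨_ (Boolₚ.∧-comm (a ≡ᵇ y) _) (Boolₚ.∧-comm (a ≡ᵇ x) _))

  link-x-u : link x u ≡ true
  link-x-u rewrite ≡ᵇ-refl x | ≡ᵇ-refl u = refl

  link-y-v : link y v ≡ true
  link-y-v rewrite ≡ᵇ-refl y | ≡ᵇ-refl v = Boolₚ.∨-zeroʳ _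

  link-true : ∀ {a h} → link a h ≡ true → (a ≡ x × h ≡ u) ⊎ (a ≡ y × h ≡ v)
  link-true {a} {h} e with a ≡ᵇ x in ax | h ≡ᵇ u in hu | a ≡ᵇ y in ay | h ≡ᵇ v in hv
  ... | true | true | _ | _ = inj₁ (≡ᵇ-true⇒≡ ax , ≡ᵇ-true⇒≡ hu)
  ... | true | false | true | true = inj₂ (≡ᵇ-true⇒≡ ay , ≡ᵇ-true⇒≡ hv)
  ... | false | _ | true | true = inj₂ (≡ᵇ-true⇒≡ ay , ≡ᵇ-true⇒≡ hv)
  link-true () | true | false | true | false
  link-true () | true | false | false | _
  link-true () | false | _ | true | false
  link-true () | false | _ | false | _

  isXY-x-y : isXY x y ≡ true
  isXY-x-y rewrite ≡ᵇ-refl x | ≡ᵇ-refl y = refl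

  isXY-y-x : isXY y x ≡ true
  isXY-y-x rewrite ≡ᵇ-refl x | ≡ᵇ-refl y = Boolₚ.∨-zeroʳ _

  isXY-true : ∀ {a b} → isXY a b ≡ true → (a ≡ x × b ≡ y) ⊎ (a ≡ y × b ≡ x)
  isXY-true {a} {b} e with a ≡ᵇ x in ax | b ≡ᵇ y in by | a ≡ᵇ y in ay | b ≡ᵇ x in bx
  ... | true | true | _ | _ = inj₁ (≡ᵇ-true⇒≡ ax , ≡ᵇ-true⇒≡ by)
  ... | true | false | true | true = inj₂ (≡ᵇ-true⇒≡ ay , ≡ᵇ-true⇒≡ bx)
  ... | false | _ | true | true = inj₂ (≡ᵇ-true⇒≡ ay , ≡ᵇ-true⇒≡ bx)
  isXY-true () | true | false | true | false
  isXY-true () | true | false | false | _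
  isXY-true () | false | _ | true | false
  isXY-true () | false | _ | false | _

  glue⊎ : (Fin m → Fin m → Bool) → (Fin n → Fin n → Bool) → Fin m ⊎ Fin n → Fin m ⊎ Fin n → Bool
  glue⊎ f g (inj₁ a) (inj₁ b) = not (isXY a b) ∧ f a b
  glue⊎ f g (inj₁ a) (inj₂ h) = link a h
  glue⊎ f g (inj₂ h) (inj₁ a) = link a h
  glue⊎ f g (inj₂ h) (inj₂ h′) = g h h′

  glue : (Fin m → Fin m → Bool) → (Fin n → Fin n → Bool) → Fin (m + n) → Fin (m + n) → Bool
  glue f g i j = glue⊎ f g (splitAt m i) (splitAt m j)

  module _ (f : Fin m → Fin m → Bool) (g : Fin n → Fin n → Bool) where

    glue-ll : ∀ a b → glue f g (a ↑ˡ n) (b ↑ˡ n) ≡ not (isXY a b) ∧ f a b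
    glue-ll a b rewrite Finₚ.splitAt-↑ˡ m a n | Finₚ.splitAt-↑ˡ m b n = refl

    glue-lr : ∀ a h → glue f g (a ↑ˡ n) (m ↑ʳ h) ≡ link a h
    glue-lr a h rewrite Finₚ.splitAt-↑ˡ m a n | Finₚ.splitAt-↑ʳ m n h = refl

    glue-rl : ∀ a h → glue f g (m ↑ʳ h) (a ↑ˡ n) ≡ link a h
    glue-rl a h rewrite Finₚ.splitAt-↑ˡ m a n | Finₚ.splitAt-↑ʳ m n h = refl

    glue-rr : ∀ h h′ → glue f g (m ↑ʳ h) (m ↑ʳ h′) ≡ g h h′
    glue-rr h h′ rewrite Finₚ.splitAt-↑ʳ m n h | Finₚ.splitAt-↑ʳ m n h′ = refl

  spliced : Graph (m + n)
  spliced = record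
    { adj = glue (adj A) (adj H)
    ; sym = λ i j → glue⊎-sym (splitAt m i) (splitAt m j)
    ; irref = λ i → glue⊎-irrefl (splitAt m i)
    }
    where
    glue⊎-sym : ∀ s t → glue⊎ (adj A) (adj H) s t ≡ glue⊎ (adj A) (adj H) t s
    glue⊎-sym (inj₁ a) (inj₁ b) = cong₂ _∧_ (cong not (isXY-sym a b)) (Graph.sym A a b)
    glue⊎-sym (inj₁ a) (inj₂ h) = refl
    glue⊎-sym (inj₂ h) (inj₁ a) = refl
    glue⊎-sym (inj₂ h) (inj₂ h′) = Graph.sym H h h′
    glue⊎-irrefl : ∀ s → glue⊎ (adj A) (adj H) s s ≡ false
    glue⊎-irrefl (inj₁ a) = trans (cong (not (isXY a a) ∧_) (irref A a)) (Boolₚ.∧-zeroʳ _)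
    glue⊎-irrefl (inj₂ h) = irref H h

  spliced-regular : ∀ r → 1 ≤ r → Regular r A → Adj A x y → u ≢ v →
    deg H u ≡ r ∸ 1 → deg H v ≡ r ∸ 1 → (∀ w → w ≢ u → w ≢ v → deg H w ≡ r) →
    Regular r spliced
  spliced-regular r r≥1 regA xy u≢v du dv dw = ↑-elim m (λ i → deg spliced i ≡ r)
    (λ a → begin
      deg spliced (a ↑ˡ n)                                                 ≡⟨ deg≡count spliced (a ↑ˡ n) ⟩
      count (adj spliced (a ↑ˡ n))                                         ≡⟨ count-↑ m _ ⟩
      count (λ b → adj spliced (a ↑ˡ n) (b ↑ˡ n)) + count (λ h → adj spliced (a ↑ˡ n) (m ↑ʳ h))
                                                                           ≡⟨ cong₂ _+_ (count-cong (glue-ll (adj A) (adj H) a))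
                                                                                        (count-cong (glue-lr (adj A) (adj H) a)) ⟩
      count (λ b → not (isXY a b) ∧ adj A a b) + count (link a)            ≡⟨ degree-left a (a Fin.≟ x) (a Fin.≟ y) ⟩
      r                                                                    ∎)
    (λ h → begin
      deg spliced (m ↑ʳ h)                                                 ≡⟨ deg≡count spliced (m ↑ʳ h) ⟩
      count (adj spliced (m ↑ʳ h))                                         ≡⟨ count-↑ m _ ⟩
      count (λ a → adj spliced (m ↑ʳ h) (a ↑ˡ n)) + count (λ h′ → adj spliced (m ↑ʳ h) (m ↑ʳ h′))
                                                                           ≡⟨ cong₂ _+_ (count-cong (λ a → glue-rl (adj A) (adj H) a h))
                                                                                        (count-cong (glue-rr (adj A) (adj H) h)) ⟩
      count (λ a → link a h) + count (adj H h)                             ≡⟨ degree-right h (h Fin.≟ u) (h Fin.≟ v) ⟩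
      r                                                                    ∎)
    where
    open ≡-Reasoning
    x≢y : x ≢ y
    x≢y = Adj⇒≢ A xy

    -- At x the edge to y is traded for the edge to u, and similarly at y.
    degree-left : ∀ a → Dec (a ≡ x) → Dec (a ≡ y) →
      count (λ b → not (isXY a b) ∧ adj A a b) + count (link a) ≡ r
    degree-left a (yes refl) (yes refl) = ⊥-elim (x≢y refl)
    degree-left a (yes refl) (no _) = begin
      count (λ b → not (isXY x b) ∧ adj A x b) + count (link x)   ≡⟨ cong₂ _+_ refl (count-single _ u link-x-u only-u) ⟩
      count (λ b → not (isXY x b) ∧ adj A x b) + 1                ≡⟨ ℕₚ.+-comm _ 1 ⟩
      suc (count (λ b → not (isXY x b) ∧ adj A x b))              ≡⟨ sym (count-remove (adj A x) _ y keep xy drop) ⟩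
      count (adj A x)                                             ≡⟨ sym (deg≡count A x) ⟩
      deg A x                                                     ≡⟨ regA x ⟩
      r                                                           ∎
      where
      only-u : ∀ h → h ≢ u → link x h ≡ false
      only-u h h≢u rewrite ≡ᵇ-refl x | ≢⇒≡ᵇ-false h≢u | ≢⇒≡ᵇ-false x≢y = refl
      keep : ∀ b → b ≢ y → adj A x b ≡ not (isXY x b) ∧ adj A x b
      keep b b≢y rewrite ≡ᵇ-refl x | ≢⇒≡ᵇ-false b≢y | ≢⇒≡ᵇ-false x≢y = refl
      drop : not (isXY x y) ∧ adj A x y ≡ false
      drop rewrite isXY-x-y = refl
    degree-left a (no a≢x) (yes refl) = begin
      count (λ b → not (isXY y b) ∧ adj A y b) + count (link y)   ≡⟨ cong₂ _+_ refl (count-single _ v link-y-v only-v) ⟩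
      count (λ b → not (isXY y b) ∧ adj A y b) + 1                ≡⟨ ℕₚ.+-comm _ 1 ⟩
      suc (count (λ b → not (isXY y b) ∧ adj A y b))              ≡⟨ sym (count-remove (adj A y) _ x keep (Adj-sym A xy) drop) ⟩
      count (adj A y)                                             ≡⟨ sym (deg≡count A y) ⟩
      deg A y                                                     ≡⟨ regA y ⟩
      r                                                           ∎
      where
      only-v : ∀ h → h ≢ v → link y h ≡ false
      only-v h h≢v rewrite ≡ᵇ-refl y | ≢⇒≡ᵇ-false h≢v | ≢⇒≡ᵇ-false a≢x = refl
      keep : ∀ b → b ≢ x → adj A y b ≡ not (isXY y b) ∧ adj A y b
      keep b b≢x rewrite ≡ᵇ-refl y | ≢⇒≡ᵇ-false b≢x | ≢⇒≡ᵇ-false a≢x = refl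
      drop : not (isXY y x) ∧ adj A y x ≡ false
      drop rewrite isXY-y-x = refl
    degree-left a (no a≢x) (no a≢y) = begin
      count (λ b → not (isXY a b) ∧ adj A a b) + count (link a)   ≡⟨ cong₂ _+_ (count-cong untouched) (count-none _ unlinked) ⟩
      count (adj A a) + 0                                         ≡⟨ ℕₚ.+-identityʳ _ ⟩
      count (adj A a)                                             ≡⟨ sym (deg≡count A a) ⟩
      deg A a                                                     ≡⟨ regA a ⟩
      r                                                           ∎
      where
      untouched : ∀ b → not (isXY a b) ∧ adj A a b ≡ adj A a b
      untouched b rewrite ≢⇒≡ᵇ-false a≢x | ≢⇒≡ᵇ-false a≢y = refl
      unlinked : ∀ h → link a h ≡ false
      unlinked h rewrite ≢⇒≡ᵇ-false a≢x | ≢⇒≡ᵇ-false a≢y = refl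

    degree-right : ∀ h → Dec (h ≡ u) → Dec (h ≡ v) →
      count (λ a → link a h) + count (adj H h) ≡ r
    degree-right h (yes refl) (yes refl) = ⊥-elim (u≢v refl)
    degree-right h (yes refl) (no _) = begin
      count (λ a → link a u) + count (adj H u)   ≡⟨ cong₂ _+_ (count-single _ x link-x-u only-x) (sym (deg≡count H u)) ⟩
      1 + deg H u                                ≡⟨ cong suc du ⟩
      1 + (r ∸ 1)                                ≡⟨ ℕₚ.m+[n∸m]≡n r≥1 ⟩
      r                                          ∎
      where
      only-x : ∀ a → a ≢ x → link a u ≡ false
      only-x a a≢x rewrite ≢⇒≡ᵇ-false a≢x | ≢⇒≡ᵇ-false u≢v = Boolₚ.∧-zeroʳ _
    degree-right h (no h≢u) (yes refl) = begin
      count (λ a → link a v) + count (adj H v)   ≡⟨ cong₂ _+_ (count-single _ y link-y-v only-y) (sym (deg≡count H v)) ⟩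
      1 + deg H v                                ≡⟨ cong suc dv ⟩
      1 + (r ∸ 1)                                ≡⟨ ℕₚ.m+[n∸m]≡n r≥1 ⟩
      r                                          ∎
      where
      only-y : ∀ a → a ≢ y → link a v ≡ false
      only-y a a≢y rewrite ≢⇒≡ᵇ-false a≢y | ≢⇒≡ᵇ-false h≢u | Boolₚ.∧-zeroʳ (a ≡ᵇ x) = refl
    degree-right h (no h≢u) (no h≢v) = begin
      count (λ a → link a h) + count (adj H h)   ≡⟨ cong₂ _+_ (count-none _ unlinked) (sym (deg≡count H h)) ⟩
      deg H h                                    ≡⟨ dw h h≢u h≢v ⟩
      r                                          ∎
      where
      unlinked : ∀ a → link a h ≡ false
      unlinked a rewrite ≢⇒≡ᵇ-false h≢u | ≢⇒≡ᵇ-false h≢v | Boolₚ.∧-zeroʳ (a ≡ᵇ x) | Boolₚ.∧-zeroʳ (a ≡ᵇ y) = refl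

  splicedEdges : EdgeSet m → EdgeSet n → EdgeSet (m + n)
  splicedEdges EA EH = fromEntries (glue (entry EA) (entry EH))

  rightPart : EdgeSet (m + n) → EdgeSet n
  rightPart E = fromEntries (λ i j → entry E (m ↑ʳ i) (m ↑ʳ j))

  leftPart : EdgeSet (m + n) → EdgeSet m
  leftPart E = fromEntries (λ i j → if isXY i j then true else entry E (i ↑ˡ n) (j ↑ˡ n))

  rightPart-splicedEdges : ∀ EA EH → rightPart (splicedEdges EA EH) ≡ EH
  rightPart-splicedEdges EA EH = sym (≡-fromEntries EH _ λ h h′ →
    sym (trans (entry-fromEntries _ (m ↑ʳ h) (m ↑ʳ h′)) (glue-rr (entry EA) (entry EH) h h′)))

  leftPart-splicedEdges : ∀ EA EH → EA ∋ₑ x , y → EA ∋ₑ y , x → leftPart (splicedEdges EA EH) ≡ EA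
  leftPart-splicedEdges EA EH xy yx = sym (≡-fromEntries EA _ entries)
    where
    entries : ∀ i j → entry EA i j ≡ (if isXY i j then true else entry (splicedEdges EA EH) (i ↑ˡ n) (j ↑ˡ n))
    entries i j with isXY i j in t
    ... | true with isXY-true {i} {j} t
    ... | inj₁ (refl , refl) = xy
    ... | inj₂ (refl , refl) = yx
    entries i j | false = sym (begin
      entry (splicedEdges EA EH) (i ↑ˡ n) (j ↑ˡ n)   ≡⟨ entry-fromEntries _ (i ↑ˡ n) (j ↑ˡ n) ⟩
      glue (entry EA) (entry EH) (i ↑ˡ n) (j ↑ˡ n)   ≡⟨ glue-ll (entry EA) (entry EH) i j ⟩
      not (isXY i j) ∧ entry EA i j                  ≡⟨ cong (λ b → not b ∧ entry EA i j) t ⟩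
      entry EA i j                                   ∎)
      where open ≡-Reasoning

module Concat {m n : ℕ} (m≥1 : 1 ≤ m) (n≥1 : 1 ≤ n) where

  concat : (Fin m → Fin m) → (Fin n → Fin n) → Fin (m + n) → Fin (m + n)
  concat pA pH i = [ (λ a → pA a ↑ˡ n) , (λ h → m ↑ʳ pH h) ]′ (splitAt m i)

  concat-↑ˡ : ∀ pA pH a → concat pA pH (a ↑ˡ n) ≡ pA a ↑ˡ n
  concat-↑ˡ pA pH a rewrite Finₚ.splitAt-↑ˡ m a n = refl

  concat-↑ʳ : ∀ pA pH h → concat pA pH (m ↑ʳ h) ≡ m ↑ʳ pH h
  concat-↑ʳ pA pH h rewrite Finₚ.splitAt-↑ʳ m n h = refl

  concat-bijective : ∀ {pA pH} → Bijective _≡_ _≡_ pA → Bijective _≡_ _≡_ pH →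
    Bijective _≡_ _≡_ (concat pA pH)
  concat-bijective {pA} {pH} bA bH = mkBijective (λ {c} {d} → injective c d) surjective
    where
    injective : ∀ c d → concat pA pH c ≡ concat pA pH d → c ≡ d
    injective = ↑-elim m (λ c → ∀ d → concat pA pH c ≡ concat pA pH d → c ≡ d)
      (λ a → ↑-elim m (λ d → concat pA pH (a ↑ˡ n) ≡ concat pA pH d → a ↑ˡ n ≡ d)
        (λ b e → cong (_↑ˡ n) (proj₁ bA (Finₚ.↑ˡ-injective n _ _
                   (trans (sym (concat-↑ˡ pA pH a)) (trans e (concat-↑ˡ pA pH b))))))
        (λ h e → ⊥-elim (↑ˡ≢↑ʳ (pA a) (pH h) (trans (sym (concat-↑ˡ pA pH a)) (trans e (concat-↑ʳ pA pH h))))))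
      (λ h → ↑-elim m (λ d → concat pA pH (m ↑ʳ h) ≡ concat pA pH d → m ↑ʳ h ≡ d)
        (λ b e → ⊥-elim (↑ˡ≢↑ʳ (pA b) (pH h) (sym (trans (sym (concat-↑ʳ pA pH h)) (trans e (concat-↑ˡ pA pH b))))))
        (λ h′ e → cong (m ↑ʳ_) (proj₁ bH (Finₚ.↑ʳ-injective m _ _
                    (trans (sym (concat-↑ʳ pA pH h)) (trans e (concat-↑ʳ pA pH h′)))))))
    surjective : ∀ w → ∃ λ c → concat pA pH c ≡ w
    surjective = ↑-elim m (λ w → ∃ λ c → concat pA pH c ≡ w)
      (λ a → let (a′ , e) = preimage bA a in a′ ↑ˡ n , trans (concat-↑ˡ pA pH a′) (cong (_↑ˡ n) e))
      (λ h → let (h′ , e) = preimage bH h in m ↑ʳ h′ , trans (concat-↑ʳ pA pH h′) (cong (m ↑ʳ_) e))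

  concat-bijective⁻¹ : ∀ {pA pH} → Bijective _≡_ _≡_ (concat pA pH) →
    Bijective _≡_ _≡_ pA × Bijective _≡_ _≡_ pH
  concat-bijective⁻¹ {pA} {pH} (inj , sur) =
    mkBijective injectiveA (λ a → surjectiveA a (preimage (inj , sur) (a ↑ˡ n))) ,
    mkBijective injectiveH (λ h → surjectiveH h (preimage (inj , sur) (m ↑ʳ h)))
    where
    injectiveA : ∀ {a b} → pA a ≡ pA b → a ≡ b
    injectiveA {a} {b} e = Finₚ.↑ˡ-injective n _ _ (inj (trans (concat-↑ˡ pA pH a)
      (trans (cong (_↑ˡ n) e) (sym (concat-↑ˡ pA pH b)))))
    injectiveH : ∀ {h h′} → pH h ≡ pH h′ → h ≡ h′
    injectiveH {h} {h′} e = Finₚ.↑ʳ-injective m _ _ (inj (trans (concat-↑ʳ pA pH h)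
      (trans (cong (m ↑ʳ_) e) (sym (concat-↑ʳ pA pH h′)))))
    surjectiveA : ∀ a → (∃ λ c → concat pA pH c ≡ a ↑ˡ n) → ∃ λ a′ → pA a′ ≡ a
    surjectiveA a (c , e) = ↑-elim m (λ c → concat pA pH c ≡ a ↑ˡ n → ∃ λ a′ → pA a′ ≡ a)
      (λ a′ e → a′ , Finₚ.↑ˡ-injective n _ _ (trans (sym (concat-↑ˡ pA pH a′)) e))
      (λ h e → ⊥-elim (↑ˡ≢↑ʳ a (pH h) (trans (sym e) (concat-↑ʳ pA pH h)))) c e
    surjectiveH : ∀ h → (∃ λ c → concat pA pH c ≡ m ↑ʳ h) → ∃ λ h′ → pH h′ ≡ h
    surjectiveH h (c , e) = ↑-elim m (λ c → concat pA pH c ≡ m ↑ʳ h → ∃ λ h′ → pH h′ ≡ h)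
      (λ a e → ⊥-elim (↑ˡ≢↑ʳ (pA a) h (trans (sym (concat-↑ˡ pA pH a)) e)))
      (λ h′ e → h′ , Finₚ.↑ʳ-injective m _ _ (trans (sym (concat-↑ʳ pA pH h′)) e)) c e

  data CycStep (c d : Fin (m + n)) : Set where
    inside-left : ∀ a b → c ≡ a ↑ˡ n → d ≡ b ↑ˡ n → LinNext a b → CycStep c d
    inside-right : ∀ h h′ → c ≡ m ↑ʳ h → d ≡ m ↑ʳ h′ → LinNext h h′ → CycStep c d
    left→right : ∀ a h → c ≡ a ↑ˡ n → d ≡ m ↑ʳ h → suc (toℕ a) ≡ m → toℕ h ≡ 0 → CycStep c d
    right→left : ∀ h a → c ≡ m ↑ʳ h → d ≡ a ↑ˡ n → suc (toℕ h) ≡ n → toℕ a ≡ 0 → CycStep c d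

  cycStep : ∀ c d → CycNext c d → CycStep c d
  cycStep = ↑-elim m (λ c → ∀ d → CycNext c d → CycStep c d)
    (λ a → ↑-elim m (λ d → CycNext (a ↑ˡ n) d → CycStep (a ↑ˡ n) d) (left-left a) (left-right a))
    (λ h → ↑-elim m (λ d → CycNext (m ↑ʳ h) d → CycStep (m ↑ʳ h) d) (right-left h) (right-right h))
    where
    m+h≢0 : ∀ (h : Fin n) → toℕ (m ↑ʳ h) ≢ 0
    m+h≢0 h e = ℕₚ.<-irrefl (sym e)
      (subst (0 <_) (sym (toℕ-↑ʳ m h)) (ℕₚ.<-≤-trans m≥1 (ℕₚ.m≤m+n m (toℕ h))))
    left-left : ∀ a b → CycNext (a ↑ˡ n) (b ↑ˡ n) → CycStep (a ↑ˡ n) (b ↑ˡ n)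
    left-left a b (inj₁ e) = inside-left a b refl refl
      (trans (sym (toℕ-↑ˡ b n)) (trans e (cong suc (toℕ-↑ˡ a n))))
    left-left a b (inj₂ (a+1≡m+n , _)) = ⊥-elim (ℕₚ.<⇒≱ (ℕₚ.m<m+n m n≥1)
      (subst (_≤ m) (trans (cong suc (sym (toℕ-↑ˡ a n))) a+1≡m+n) (toℕ<n a)))
    left-right : ∀ a h → CycNext (a ↑ˡ n) (m ↑ʳ h) → CycStep (a ↑ˡ n) (m ↑ʳ h)
    left-right a h (inj₁ e) = left→right a h refl refl
      (trans (sym m+h≡a+1) (trans (cong (m +_) h≡0) (ℕₚ.+-identityʳ m))) h≡0
      where
      m+h≡a+1 : m + toℕ h ≡ suc (toℕ a)
      m+h≡a+1 = trans (sym (toℕ-↑ʳ m h)) (trans e (cong suc (toℕ-↑ˡ a n)))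
      h≡0 : toℕ h ≡ 0
      h≡0 = ℕₚ.n≤0⇒n≡0 (ℕₚ.+-cancelˡ-≤ m (toℕ h) 0
        (subst (m + toℕ h ≤_) (sym (ℕₚ.+-identityʳ m)) (subst (_≤ m) (sym m+h≡a+1) (toℕ<n a))))
    left-right a h (inj₂ (_ , e)) = ⊥-elim (m+h≢0 h e)
    right-left : ∀ h a → CycNext (m ↑ʳ h) (a ↑ˡ n) → CycStep (m ↑ʳ h) (a ↑ˡ n)
    right-left h a (inj₁ e) = ⊥-elim (ℕₚ.<⇒≱ (toℕ<n a) (begin
      m                     ≤⟨ ℕₚ.m≤m+n m (toℕ h) ⟩
      m + toℕ h             ≤⟨ ℕₚ.n≤1+n _ ⟩
      suc (m + toℕ h)       ≡⟨ cong suc (sym (toℕ-↑ʳ m h)) ⟩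
      suc (toℕ (m ↑ʳ h))    ≡⟨ sym e ⟩
      toℕ (a ↑ˡ n)          ≡⟨ toℕ-↑ˡ a n ⟩
      toℕ a                 ∎))
      where open ℕₚ.≤-Reasoning
    right-left h a (inj₂ (e₁ , e₂)) = right→left h a refl refl
      (ℕₚ.+-cancelˡ-≡ m _ _ (trans (ℕₚ.+-suc m (toℕ h)) (trans (cong suc (sym (toℕ-↑ʳ m h))) e₁)))
      (trans (sym (toℕ-↑ˡ a n)) e₂)
    right-right : ∀ h h′ → CycNext (m ↑ʳ h) (m ↑ʳ h′) → CycStep (m ↑ʳ h) (m ↑ʳ h′)
    right-right h h′ (inj₁ e) = inside-right h h′ refl refl (ℕₚ.+-cancelˡ-≡ m _ _
      (trans (sym (toℕ-↑ʳ m h′)) (trans e (trans (cong suc (toℕ-↑ʳ m h)) (sym (ℕₚ.+-suc m (toℕ h)))))))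
    right-right h h′ (inj₂ (_ , e)) = ⊥-elim (m+h≢0 h′ e)

  CycNext-↑ˡ : ∀ {a b : Fin m} → LinNext a b → CycNext (a ↑ˡ n) (b ↑ˡ n)
  CycNext-↑ˡ {a} {b} e = inj₁ (trans (toℕ-↑ˡ b n) (trans e (cong suc (sym (toℕ-↑ˡ a n)))))

  CycNext-↑ʳ : ∀ {h h′ : Fin n} → LinNext h h′ → CycNext {m + n} (m ↑ʳ h) (m ↑ʳ h′)
  CycNext-↑ʳ {h} {h′} e = inj₁ (trans (toℕ-↑ʳ m h′)
    (trans (cong (m +_) e) (trans (ℕₚ.+-suc m _) (cong suc (sym (toℕ-↑ʳ m h))))))

  CycNext-left→right : ∀ {a : Fin m} {h : Fin n} → suc (toℕ a) ≡ m → toℕ h ≡ 0 → CycNext (a ↑ˡ n) (m ↑ʳ h)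
  CycNext-left→right {a} {h} a+1≡m h≡0 = inj₁ (trans (toℕ-↑ʳ m h)
    (trans (cong (m +_) h≡0) (trans (ℕₚ.+-identityʳ m) (trans (sym a+1≡m) (cong suc (sym (toℕ-↑ˡ a n)))))))

  CycNext-right→left : ∀ {h : Fin n} {a : Fin m} → suc (toℕ h) ≡ n → toℕ a ≡ 0 → CycNext (m ↑ʳ h) (a ↑ˡ n)
  CycNext-right→left {h} {a} h+1≡n a≡0 =
    inj₂ (trans (cong suc (toℕ-↑ʳ m h)) (trans (sym (ℕₚ.+-suc m _)) (cong (m +_) h+1≡n)) , trans (toℕ-↑ˡ a n) a≡0)

module SplicedOrder {m n} (A : Graph m) (x y : Fin m) (H : Graph n) (u v : Fin n)
  (m≥3 : 3 ≤ m) (n≥1 : 1 ≤ n) (pA : Fin m → Fin m) (pH : Fin n → Fin n)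
  (pA-injective : ∀ {a b} → pA a ≡ pA b → a ≡ b)
  (pA-first : ∀ a → toℕ a ≡ 0 → pA a ≡ y) (pA-last : ∀ a → suc (toℕ a) ≡ m → pA a ≡ x)
  (pH-first : ∀ h → toℕ h ≡ 0 → pH h ≡ u) (pH-last : ∀ h → suc (toℕ h) ≡ n → pH h ≡ v) where

  open Splice A x y H u v
  private
    m≥1 : 1 ≤ m
    m≥1 = ℕₚ.≤-trans (s≤s z≤n) m≥3
  open Concat m≥1 n≥1

  q : Fin (m + n) → Fin (m + n)
  q = concat pA pH

  private
    firstA : Fin m
    firstA = proj₁ (firstPosition m≥1)
    firstA≡0 : toℕ firstA ≡ 0
    firstA≡0 = proj₂ (firstPosition m≥1)
    lastA : Fin m
    lastA = proj₁ (lastPosition m≥1)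
    lastA+1≡m : suc (toℕ lastA) ≡ m
    lastA+1≡m = proj₂ (lastPosition m≥1)
    firstH : Fin n
    firstH = proj₁ (firstPosition n≥1)
    firstH≡0 : toℕ firstH ≡ 0
    firstH≡0 = proj₂ (firstPosition n≥1)
    lastH : Fin n
    lastH = proj₁ (lastPosition n≥1)
    lastH+1≡n : suc (toℕ lastH) ≡ n
    lastH+1≡n = proj₂ (lastPosition n≥1)

    q-↑ˡ : ∀ {a i} → pA a ≡ i → q (a ↑ˡ n) ≡ i ↑ˡ n
    q-↑ˡ {a} e = trans (concat-↑ˡ pA pH a) (cong (_↑ˡ n) e)

    q-↑ʳ : ∀ {h i} → pH h ≡ i → q (m ↑ʳ h) ≡ m ↑ʳ i
    q-↑ʳ {h} e = trans (concat-↑ʳ pA pH h) (cong (m ↑ʳ_) e)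

    q-↑ˡ⁻¹ : ∀ {a i} → q (a ↑ˡ n) ≡ i ↑ˡ n → pA a ≡ i
    q-↑ˡ⁻¹ {a} e = Finₚ.↑ˡ-injective n _ _ (trans (sym (concat-↑ˡ pA pH a)) e)

    q-↑ʳ⁻¹ : ∀ {h i} → q (m ↑ʳ h) ≡ m ↑ʳ i → pH h ≡ i
    q-↑ʳ⁻¹ {h} e = Finₚ.↑ʳ-injective m _ _ (trans (sym (concat-↑ʳ pA pH h)) e)

    q-↑ˡ≢ : ∀ a h → q (a ↑ˡ n) ≢ m ↑ʳ h
    q-↑ˡ≢ a h e = ↑ˡ≢↑ʳ (pA a) h (trans (sym (concat-↑ˡ pA pH a)) e)

    q-↑ʳ≢ : ∀ h a → q (m ↑ʳ h) ≢ a ↑ˡ n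
    q-↑ʳ≢ h a e = ↑ˡ≢↑ʳ a (pH h) (sym (trans (sym (concat-↑ʳ pA pH h)) e))

    x-last : ∀ {a} → pA a ≡ x → suc (toℕ a) ≡ m
    x-last {a} e = trans (cong (λ c → suc (toℕ c)) (pA-injective (trans e (sym (pA-last lastA lastA+1≡m))))) lastA+1≡m

    y-first : ∀ {a} → pA a ≡ y → toℕ a ≡ 0
    y-first {a} e = trans (cong toℕ (pA-injective (trans e (sym (pA-first firstA firstA≡0))))) firstA≡0

    x-not-before : ∀ {a b} → LinNext a b → pA a ≡ x → ⊥
    x-not-before {a} {b} e ax = ℕₚ.<-irrefl (trans e (x-last ax)) (toℕ<n b)

    y-not-before-x : ∀ {a b} → LinNext a b → pA a ≡ y → pA b ≡ x → ⊥
    y-not-before-x e ay bx = ℕₚ.<-irrefl (sym m≡2) (ℕₚ.≤-<-trans (s≤s (s≤s z≤n)) m≥3)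
      where
      m≡2 : m ≡ 2
      m≡2 = trans (sym (x-last bx)) (cong suc (trans e (cong suc (y-first ay))))

  consecutive-left : ∀ {i j} → Consecutive CycNext q (i ↑ˡ n) (j ↑ˡ n) ⇔ Consecutive LinNext pA i j
  consecutive-left = mk⇔ to from
    where
    to : ∀ {i j} → Consecutive CycNext q (i ↑ˡ n) (j ↑ˡ n) → Consecutive LinNext pA i j
    to (c , d , next , pair) with cycStep c d next | pair
    ... | inside-left a b refl refl e | inj₁ (e₁ , e₂) = a , b , e , inj₁ (q-↑ˡ⁻¹ e₁ , q-↑ˡ⁻¹ e₂)
    ... | inside-left a b refl refl e | inj₂ (e₁ , e₂) = a , b , e , inj₂ (q-↑ˡ⁻¹ e₁ , q-↑ˡ⁻¹ e₂)
    ... | inside-right h _ refl refl _ | inj₁ (e₁ , _) = ⊥-elim (q-↑ʳ≢ h _ e₁)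
    ... | inside-right h _ refl refl _ | inj₂ (e₁ , _) = ⊥-elim (q-↑ʳ≢ h _ e₁)
    ... | left→right _ h refl refl _ _ | inj₁ (_ , e₂) = ⊥-elim (q-↑ʳ≢ h _ e₂)
    ... | left→right _ h refl refl _ _ | inj₂ (_ , e₂) = ⊥-elim (q-↑ʳ≢ h _ e₂)
    ... | right→left h _ refl refl _ _ | inj₁ (e₁ , _) = ⊥-elim (q-↑ʳ≢ h _ e₁)
    ... | right→left h _ refl refl _ _ | inj₂ (e₁ , _) = ⊥-elim (q-↑ʳ≢ h _ e₁)
    from : ∀ {i j} → Consecutive LinNext pA i j → Consecutive CycNext q (i ↑ˡ n) (j ↑ˡ n)
    from (a , b , e , pair) =
      a ↑ˡ n , b ↑ˡ n , CycNext-↑ˡ e , Sum.map (λ (e₁ , e₂) → q-↑ˡ e₁ , q-↑ˡ e₂) (λ (e₁ , e₂) → q-↑ˡ e₁ , q-↑ˡ e₂) pair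

  consecutive-right : ∀ {i j} → Consecutive CycNext q (m ↑ʳ i) (m ↑ʳ j) ⇔ Consecutive LinNext pH i j
  consecutive-right = mk⇔ to from
    where
    to : ∀ {i j} → Consecutive CycNext q (m ↑ʳ i) (m ↑ʳ j) → Consecutive LinNext pH i j
    to (c , d , next , pair) with cycStep c d next | pair
    ... | inside-right h h′ refl refl e | inj₁ (e₁ , e₂) = h , h′ , e , inj₁ (q-↑ʳ⁻¹ e₁ , q-↑ʳ⁻¹ e₂)
    ... | inside-right h h′ refl refl e | inj₂ (e₁ , e₂) = h , h′ , e , inj₂ (q-↑ʳ⁻¹ e₁ , q-↑ʳ⁻¹ e₂)
    ... | inside-left a _ refl refl _ | inj₁ (e₁ , _) = ⊥-elim (q-↑ˡ≢ a _ e₁)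
    ... | inside-left a _ refl refl _ | inj₂ (e₁ , _) = ⊥-elim (q-↑ˡ≢ a _ e₁)
    ... | left→right a _ refl refl _ _ | inj₁ (e₁ , _) = ⊥-elim (q-↑ˡ≢ a _ e₁)
    ... | left→right a _ refl refl _ _ | inj₂ (e₁ , _) = ⊥-elim (q-↑ˡ≢ a _ e₁)
    ... | right→left _ a refl refl _ _ | inj₁ (_ , e₂) = ⊥-elim (q-↑ˡ≢ a _ e₂)
    ... | right→left _ a refl refl _ _ | inj₂ (_ , e₂) = ⊥-elim (q-↑ˡ≢ a _ e₂)
    from : ∀ {i j} → Consecutive LinNext pH i j → Consecutive CycNext q (m ↑ʳ i) (m ↑ʳ j)
    from (h , h′ , e , pair) =
      m ↑ʳ h , m ↑ʳ h′ , CycNext-↑ʳ e , Sum.map (λ (e₁ , e₂) → q-↑ʳ e₁ , q-↑ʳ e₂) (λ (e₁ , e₂) → q-↑ʳ e₁ , q-↑ʳ e₂) pair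

  consecutive-link : ∀ {i h} → Consecutive CycNext q (i ↑ˡ n) (m ↑ʳ h) ⇔ (link i h ≡ true)
  consecutive-link = mk⇔ to from
    where
    to : ∀ {i h} → Consecutive CycNext q (i ↑ˡ n) (m ↑ʳ h) → link i h ≡ true
    to (c , d , next , pair) with cycStep c d next | pair
    ... | inside-left a _ refl refl _ | inj₁ (_ , e₂) = ⊥-elim (q-↑ˡ≢ _ _ e₂)
    ... | inside-left a _ refl refl _ | inj₂ (e₁ , _) = ⊥-elim (q-↑ˡ≢ a _ e₁)
    ... | inside-right h _ refl refl _ | inj₁ (e₁ , _) = ⊥-elim (q-↑ʳ≢ h _ e₁)
    ... | inside-right _ _ refl refl _ | inj₂ (_ , e₂) = ⊥-elim (q-↑ʳ≢ _ _ e₂)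
    ... | left→right a h refl refl a-last h-first | inj₁ (e₁ , e₂) =
      subst₂ (λ i h → link i h ≡ true) (trans (sym (pA-last a a-last)) (q-↑ˡ⁻¹ e₁))
        (trans (sym (pH-first h h-first)) (q-↑ʳ⁻¹ e₂)) link-x-u
    ... | left→right a _ refl refl _ _ | inj₂ (e₁ , _) = ⊥-elim (q-↑ˡ≢ a _ e₁)
    ... | right→left h _ refl refl _ _ | inj₁ (e₁ , _) = ⊥-elim (q-↑ʳ≢ h _ e₁)
    ... | right→left h a refl refl h-last a-first | inj₂ (e₁ , e₂) =
      subst₂ (λ i h → link i h ≡ true) (trans (sym (pA-first a a-first)) (q-↑ˡ⁻¹ e₂))
        (trans (sym (pH-last h h-last)) (q-↑ʳ⁻¹ e₁)) link-y-v
    from : ∀ {i h} → link i h ≡ true → Consecutive CycNext q (i ↑ˡ n) (m ↑ʳ h)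
    from {i} {h} t with link-true {i} {h} t
    ... | inj₁ (refl , refl) = lastA ↑ˡ n , m ↑ʳ firstH , CycNext-left→right lastA+1≡m firstH≡0 ,
      inj₁ (q-↑ˡ (pA-last lastA lastA+1≡m) , q-↑ʳ (pH-first firstH firstH≡0))
    ... | inj₂ (refl , refl) = m ↑ʳ lastH , firstA ↑ˡ n , CycNext-right→left lastH+1≡n firstA≡0 ,
      inj₂ (q-↑ʳ (pH-last lastH lastH+1≡n) , q-↑ˡ (pA-first firstA firstA≡0))

  consecutive-cyclic : ∀ {i j} → Consecutive CycNext pA i j ⇔ (Consecutive LinNext pA i j ⊎ isXY i j ≡ true)
  consecutive-cyclic = mk⇔ to from
    where
    to : ∀ {i j} → Consecutive CycNext pA i j → Consecutive LinNext pA i j ⊎ isXY i j ≡ true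
    to (a , b , inj₁ e , pair) = inj₁ (a , b , e , pair)
    to (a , b , inj₂ (a-last , b-first) , inj₁ (e₁ , e₂)) = inj₂ (subst₂ (λ i j → isXY i j ≡ true)
      (trans (sym (pA-last a a-last)) e₁) (trans (sym (pA-first b b-first)) e₂) isXY-x-y)
    to (a , b , inj₂ (a-last , b-first) , inj₂ (e₁ , e₂)) = inj₂ (subst₂ (λ i j → isXY i j ≡ true)
      (trans (sym (pA-first b b-first)) e₂) (trans (sym (pA-last a a-last)) e₁) isXY-y-x)
    from : ∀ {i j} → Consecutive LinNext pA i j ⊎ isXY i j ≡ true → Consecutive CycNext pA i j
    from (inj₁ (a , b , e , pair)) = a , b , inj₁ e , pair
    from {i} {j} (inj₂ t) with isXY-true {i} {j} t
    ... | inj₁ (refl , refl) = lastA , firstA , inj₂ (lastA+1≡m , firstA≡0) ,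
      inj₁ (pA-last lastA lastA+1≡m , pA-first firstA firstA≡0)
    ... | inj₂ (refl , refl) = lastA , firstA , inj₂ (lastA+1≡m , firstA≡0) ,
      inj₂ (pA-last lastA lastA+1≡m , pA-first firstA firstA≡0)

  -- For m = 2 the two ends x and y of the linear order would be consecutive.
  linear-¬isXY : ∀ {i j} → Consecutive LinNext pA i j → isXY i j ≡ false
  linear-¬isXY {i} {j} (a , b , e , pair) with isXY i j in t
  ... | false = refl
  ... | true with isXY-true {i} {j} t | pair
  ... | inj₁ (refl , refl) | inj₁ (e₁ , _) = ⊥-elim (x-not-before e e₁)
  ... | inj₁ (refl , refl) | inj₂ (e₁ , e₂) = ⊥-elim (y-not-before-x e e₁ e₂)
  ... | inj₂ (refl , refl) | inj₁ (e₁ , e₂) = ⊥-elim (y-not-before-x e e₁ e₂)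
  ... | inj₂ (refl , refl) | inj₂ (e₁ , _) = ⊥-elim (x-not-before e e₁)

  splicedEdges-order : ∀ EA EH → EdgesOf CycNext pA EA → EdgesOf LinNext pH EH →
    EdgesOf CycNext q (splicedEdges EA EH)
  splicedEdges-order EA EH edgesA edgesH = ↑-elim m (λ i → ∀ j → (splicedEdges EA EH ∋ₑ i , j) ⇔ Consecutive CycNext q i j)
    (λ a → ↑-elim m (λ j → (splicedEdges EA EH ∋ₑ (a ↑ˡ n) , j) ⇔ Consecutive CycNext q (a ↑ˡ n) j) (left-left a) (left-right a))
    (λ h → ↑-elim m (λ j → (splicedEdges EA EH ∋ₑ (m ↑ʳ h) , j) ⇔ Consecutive CycNext q (m ↑ʳ h) j) (right-left h) (right-right h))
    where
    entry-glue : ∀ i j → entry (splicedEdges EA EH) i j ≡ glue (entry EA) (entry EH) i j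
    entry-glue = entry-fromEntries (glue (entry EA) (entry EH))
    left-left : ∀ a b → (splicedEdges EA EH ∋ₑ (a ↑ˡ n) , (b ↑ˡ n)) ⇔ Consecutive CycNext q (a ↑ˡ n) (b ↑ˡ n)
    left-left a b = ≡true-⇔ (trans (entry-glue (a ↑ˡ n) (b ↑ˡ n)) (glue-ll (entry EA) (entry EH) a b)) to from
      where
      to : not (isXY a b) ∧ entry EA a b ≡ true → Consecutive CycNext q (a ↑ˡ n) (b ↑ˡ n)
      to t with ∧-true {not (isXY a b)} t
      ... | ¬xy , ab with Equivalence.to consecutive-cyclic (Equivalence.to (edgesA a b) ab)
      ... | inj₁ linear = Equivalence.from consecutive-left linear
      ... | inj₂ xy = ⊥-elim (true≢false (trans (sym xy) (not-true ¬xy)))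
      from : Consecutive CycNext q (a ↑ˡ n) (b ↑ˡ n) → not (isXY a b) ∧ entry EA a b ≡ true
      from c rewrite linear-¬isXY (Equivalence.to consecutive-left c) =
        Equivalence.from (edgesA a b) (Equivalence.from consecutive-cyclic (inj₁ (Equivalence.to consecutive-left c)))
    left-right : ∀ a h → (splicedEdges EA EH ∋ₑ (a ↑ˡ n) , (m ↑ʳ h)) ⇔ Consecutive CycNext q (a ↑ˡ n) (m ↑ʳ h)
    left-right a h = ≡true-⇔ (trans (entry-glue (a ↑ˡ n) (m ↑ʳ h)) (glue-lr (entry EA) (entry EH) a h))
      (Equivalence.from consecutive-link) (Equivalence.to consecutive-link)
    right-left : ∀ h a → (splicedEdges EA EH ∋ₑ (m ↑ʳ h) , (a ↑ˡ n)) ⇔ Consecutive CycNext q (m ↑ʳ h) (a ↑ˡ n)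
    right-left h a = ≡true-⇔ (trans (entry-glue (m ↑ʳ h) (a ↑ˡ n)) (glue-rl (entry EA) (entry EH) a h))
      (λ t → Consecutive-sym (Equivalence.from consecutive-link t)) (λ c → Equivalence.to consecutive-link (Consecutive-sym c))
    right-right : ∀ h h′ → (splicedEdges EA EH ∋ₑ (m ↑ʳ h) , (m ↑ʳ h′)) ⇔ Consecutive CycNext q (m ↑ʳ h) (m ↑ʳ h′)
    right-right h h′ = ≡true-⇔ (trans (entry-glue (m ↑ʳ h) (m ↑ʳ h′)) (glue-rr (entry EA) (entry EH) h h′))
      (λ t → Equivalence.from consecutive-right (Equivalence.to (edgesH h h′) t))
      (λ c → Equivalence.from (edgesH h h′) (Equivalence.to consecutive-right c))

  spliced-adjacent : Adj A x y → (∀ a b → CycNext a b → Adj A (pA a) (pA b)) →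
    (∀ h h′ → LinNext h h′ → Adj H (pH h) (pH h′)) → ∀ c d → CycNext c d → Adj spliced (q c) (q d)
  spliced-adjacent xy adjA adjH c d next with cycStep c d next
  ... | inside-left a b refl refl e
    rewrite concat-↑ˡ pA pH a | concat-↑ˡ pA pH b | glue-ll (adj A) (adj H) (pA a) (pA b)
          | linear-¬isXY (a , b , e , inj₁ (refl , refl)) = adjA a b (inj₁ e)
  ... | inside-right h h′ refl refl e
    rewrite concat-↑ʳ pA pH h | concat-↑ʳ pA pH h′ | glue-rr (adj A) (adj H) (pH h) (pH h′) = adjH h h′ e
  ... | left→right a h refl refl a-last h-first
    rewrite concat-↑ˡ pA pH a | concat-↑ʳ pA pH h | glue-lr (adj A) (adj H) (pA a) (pH h)
          | pA-last a a-last | pH-first h h-first = link-x-u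
  ... | right→left h a refl refl h-last a-first
    rewrite concat-↑ˡ pA pH a | concat-↑ʳ pA pH h | glue-rl (adj A) (adj H) (pA a) (pH h)
          | pA-first a a-first | pH-last h h-last = link-y-v

-- Decomposing the hamiltonian cycles of the spliced graph

module _ {N : ℕ} where

  propagate : (P : Fin N → Set) (k : ℕ) → (∀ c → toℕ c ≡ k → P c) →
    (∀ c d → LinNext c d → k ≤ toℕ c → P c → P d) → ∀ c → k ≤ toℕ c → P c
  propagate P k base step c k≤c = go (toℕ c) c refl k≤c
    where
    go : ∀ j c → toℕ c ≡ j → k ≤ j → P c
    go j c c≡j k≤j with ℕₚ.m≤n⇒m<n∨m≡n k≤j
    ... | inj₂ refl = base c c≡j
    go (suc j) c c≡j _ | inj₁ (s≤s k≤j) = step c′ c (trans c≡j (cong suc (sym (toℕ-fromℕ< j<N))))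
      (subst (k ≤_) (sym (toℕ-fromℕ< j<N)) k≤j) (go j c′ (toℕ-fromℕ< j<N) k≤j)
      where
      j<N : j < N
      j<N = ℕₚ.<-trans (ℕₚ.n<1+n j) (subst (_< N) c≡j (toℕ<n c))
      c′ : Fin N
      c′ = fromℕ< j<N

  module SingleSwitch (s : Fin N → Bool) (p : Fin N)
    (start : ∀ c → toℕ c ≡ 0 → s c ≡ true)
    (fall : ∀ c d → LinNext c d → s c ≡ true → s d ≡ false → c ≡ p)
    (rise : ∀ c d → LinNext c d → s c ≡ false → s d ≡ true → d ≡ p)
    (w : Fin N) (s-w : s w ≡ false) where

    true-upTo : ∀ c → toℕ c ≤ toℕ p → s c ≡ true
    true-upTo c = propagate (λ c → toℕ c ≤ toℕ p → s c ≡ true) 0 (λ c c≡0 _ → start c c≡0) step c z≤n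
      where
      step : ∀ c d → LinNext c d → 0 ≤ toℕ c → (toℕ c ≤ toℕ p → s c ≡ true) → toℕ d ≤ toℕ p → s d ≡ true
      step c d d≡c+1 _ ih d≤p with s d in s-d
      ... | true = refl
      ... | false = ⊥-elim (ℕₚ.<-irrefl refl (begin-strict
        toℕ p     ≡⟨ cong toℕ (sym (fall c d d≡c+1 (ih c≤p) s-d)) ⟩
        toℕ c     <⟨ ℕₚ.n<1+n (toℕ c) ⟩
        suc (toℕ c) ≡⟨ sym d≡c+1 ⟩
        toℕ d     ≤⟨ d≤p ⟩
        toℕ p     ∎))
        where
        open ℕₚ.≤-Reasoning
        c≤p : toℕ c ≤ toℕ p
        c≤p = ℕₚ.<⇒≤ (subst (_≤ toℕ p) d≡c+1 d≤p)

    p<w : toℕ p < toℕ w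
    p<w with ℕₚ.≤-<-connex (toℕ w) (toℕ p)
    ... | inj₁ w≤p = ⊥-elim (true≢false (trans (sym (true-upTo w w≤p)) s-w))
    ... | inj₂ p<w = p<w

    false-after : ∀ c → toℕ p < toℕ c → s c ≡ false
    false-after c p<c = trans (constant c p<c) (trans (sym (constant w p<w)) s-w)
      where
      p+1<N : suc (toℕ p) < N
      p+1<N = ℕₚ.≤-<-trans p<w (toℕ<n w)
      next : Fin N
      next = fromℕ< p+1<N
      constant : ∀ c → toℕ p < toℕ c → s c ≡ s next
      constant = propagate (λ c → s c ≡ s next) (suc (toℕ p))
        (λ c c≡p+1 → cong s (≡-fromℕ< p+1<N c≡p+1)) step
        where
        step : ∀ c d → LinNext c d → suc (toℕ p) ≤ toℕ c → s c ≡ s next → s d ≡ s next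
        step c d d≡c+1 p<c ih with s c in s-c | s d in s-d
        ... | true | true = ih
        ... | false | false = ih
        ... | true | false = ⊥-elim (ℕₚ.<-irrefl (cong toℕ (sym (fall c d d≡c+1 s-c s-d))) p<c)
        ... | false | true = ⊥-elim (ℕₚ.<-irrefl (cong toℕ (sym (rise c d d≡c+1 s-c s-d)))
                                      (ℕₚ.<-trans p<c (subst (toℕ c <_) (sym d≡c+1) (ℕₚ.n<1+n _))))

prefix-length : ∀ {m n} {q : Fin (m + n) → Fin (m + n)} → Bijective _≡_ _≡_ q → (t : ℕ) → t < m + n →
  (∀ c → toℕ c ≤ t → ∃ λ a → q c ≡ a ↑ˡ n) → (∀ c → t < toℕ c → ∃ λ h → q c ≡ m ↑ʳ h) → suc t ≡ m
prefix-length {m} {n} {q} bij t t<N left right =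
  ℕₚ.≤-antisym (Finₚ.injective⇒≤ {f = toLeft} toLeft-injective) (Finₚ.injective⇒≤ {f = toPrefix} toPrefix-injective)
  where
  position : Fin m → Fin (m + n)
  position a = proj₁ (preimage bij (a ↑ˡ n))
  in-prefix : ∀ a → toℕ (position a) ≤ t
  in-prefix a with ℕₚ.≤-<-connex (toℕ (position a)) t
  ... | inj₁ ≤t = ≤t
  ... | inj₂ t< = ⊥-elim (↑ˡ≢↑ʳ a _ (trans (sym (proj₂ (preimage bij (a ↑ˡ n)))) (proj₂ (right _ t<))))
  toPrefix : Fin m → Fin (suc t)
  toPrefix a = fromℕ< (s≤s (in-prefix a))
  toPrefix-injective : ∀ {a b} → toPrefix a ≡ toPrefix b → a ≡ b
  toPrefix-injective {a} {b} e = Finₚ.↑ˡ-injective n _ _ (trans (sym (proj₂ (preimage bij (a ↑ˡ n))))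
    (trans (cong q (toℕ-injective (Finₚ.fromℕ<-injective _ _ (s≤s (in-prefix a)) (s≤s (in-prefix b)) e)))
           (proj₂ (preimage bij (b ↑ˡ n)))))
  at : Fin (suc t) → Fin (m + n)
  at k = fromℕ< (ℕₚ.≤-<-trans (ℕₚ.≤-pred (toℕ<n k)) t<N)
  at-≤ : ∀ k → toℕ (at k) ≤ t
  at-≤ k = subst (_≤ t) (sym (toℕ-fromℕ< _)) (ℕₚ.≤-pred (toℕ<n k))
  toLeft : Fin (suc t) → Fin m
  toLeft k = proj₁ (left (at k) (at-≤ k))
  toLeft-injective : ∀ {k l} → toLeft k ≡ toLeft l → k ≡ l
  toLeft-injective {k} {l} e = toℕ-injective (trans (sym (toℕ-fromℕ< _))
    (trans (cong toℕ (proj₁ bij (trans (proj₂ (left (at k) (at-≤ k)))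
                                  (trans (cong (_↑ˡ n) e) (sym (proj₂ (left (at l) (at-≤ l))))))))
           (toℕ-fromℕ< _)))

module SplicedCycles {m n} (A : Graph m) (x y : Fin m) (H : Graph n) (u v : Fin n)
  (m≥3 : 3 ≤ m) (u≢v : u ≢ v) (xy : Adj A x y) where

  open Splice A x y H u v

  m≥1 : 1 ≤ m
  m≥1 = ℕₚ.≤-trans (s≤s z≤n) m≥3

  n≥1 : 1 ≤ n
  n≥1 = ℕₚ.≤-<-trans z≤n (toℕ<n u)

  open Concat m≥1 n≥1

  isLeft : Fin (m + n) → Bool
  isLeft w = [ (λ _ → true) , (λ _ → false) ]′ (splitAt m w)

  isLeft-↑ˡ : ∀ a → isLeft (a ↑ˡ n) ≡ true
  isLeft-↑ˡ a rewrite Finₚ.splitAt-↑ˡ m a n = refl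

  isLeft-↑ʳ : ∀ h → isLeft (m ↑ʳ h) ≡ false
  isLeft-↑ʳ h rewrite Finₚ.splitAt-↑ʳ m n h = refl

  isLeft-true : ∀ w → isLeft w ≡ true → ∃ λ a → w ≡ a ↑ˡ n
  isLeft-true = ↑-elim m (λ w → isLeft w ≡ true → ∃ λ a → w ≡ a ↑ˡ n)
    (λ a _ → a , refl) (λ h e → ⊥-elim (true≢false (trans (sym e) (isLeft-↑ʳ h))))

  isLeft-false : ∀ w → isLeft w ≡ false → ∃ λ h → w ≡ m ↑ʳ h
  isLeft-false = ↑-elim m (λ w → isLeft w ≡ false → ∃ λ h → w ≡ m ↑ʳ h)
    (λ a e → ⊥-elim (true≢false (trans (sym (isLeft-↑ˡ a)) e))) (λ h _ → h , refl)

  link-x⇒u : ∀ {h} → link x h ≡ true → h ≡ u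
  link-x⇒u t with link-true t
  ... | inj₁ (_ , h≡u) = h≡u
  ... | inj₂ (x≡y , _) = ⊥-elim (Adj⇒≢ A xy x≡y)

  link-y⇒v : ∀ {h} → link y h ≡ true → h ≡ v
  link-y⇒v t with link-true t
  ... | inj₁ (y≡x , _) = ⊥-elim (Adj⇒≢ A xy (sym y≡x))
  ... | inj₂ (_ , h≡v) = h≡v

  -- Listed from y with a second vertex other than v, a hamiltonian cycle of the
  -- spliced graph runs through all of A before it enters H.
  module Blocks {E} {q} (hq : HamCycleOrder spliced E q)
    (q-first : ∀ c → toℕ c ≡ 0 → q c ≡ y ↑ˡ n) (q-second : ∀ c → toℕ c ≡ 1 → q c ≢ m ↑ʳ v) where

    private
      q-injective : ∀ {a b} → q a ≡ q b → a ≡ b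
      q-injective = proj₁ (proj₁ hq)

      cross : ∀ {c d a h} → CycNext c d → (q c ≡ a ↑ˡ n × q d ≡ m ↑ʳ h) ⊎ (q c ≡ m ↑ʳ h × q d ≡ a ↑ˡ n) →
        (a ≡ x × h ≡ u) ⊎ (a ≡ y × h ≡ v)
      cross {c} {d} {a} {h} next (inj₁ (e₁ , e₂)) = link-true
        (trans (sym (glue-lr (adj A) (adj H) a h)) (subst₂ (Adj spliced) e₁ e₂ (proj₁ (proj₂ hq) c d next)))
      cross {c} {d} {a} {h} next (inj₂ (e₁ , e₂)) = link-true
        (trans (sym (glue-rl (adj A) (adj H) a h)) (subst₂ (Adj spliced) e₁ e₂ (proj₁ (proj₂ hq) c d next)))

      start : Fin (m + n)
      start = proj₁ (firstPosition (ℕₚ.≤-trans m≥1 (ℕₚ.m≤m+n m n)))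

      start≡0 : toℕ start ≡ 0
      start≡0 = proj₂ (firstPosition (ℕₚ.≤-trans m≥1 (ℕₚ.m≤m+n m n)))

      y-at-first : ∀ {c} → q c ≡ y ↑ˡ n → toℕ c ≡ 0
      y-at-first e = trans (cong toℕ (q-injective (trans e (sym (q-first start start≡0))))) start≡0

      px : Fin (m + n)
      px = proj₁ (preimage (proj₁ hq) (x ↑ˡ n))
      q-px : q px ≡ x ↑ˡ n
      q-px = proj₂ (preimage (proj₁ hq) (x ↑ˡ n))
      pu : Fin (m + n)
      pu = proj₁ (preimage (proj₁ hq) (m ↑ʳ u))
      q-pu : q pu ≡ m ↑ʳ u
      q-pu = proj₂ (preimage (proj₁ hq) (m ↑ʳ u))

      inA : Fin (m + n) → Bool
      inA c = isLeft (q c)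

      -- The cycle can leave A only from x: leaving from y would mean entering H at v right after the start.
      fall : ∀ c d → LinNext c d → inA c ≡ true → inA d ≡ false → c ≡ px
      fall c d d≡c+1 left right with isLeft-true (q c) left | isLeft-false (q d) right
      ... | a , qa | h , qh with cross (inj₁ d≡c+1) (inj₁ (qa , qh))
      ... | inj₁ (refl , _) = q-injective (trans qa (sym q-px))
      ... | inj₂ (refl , refl) = ⊥-elim (q-second d (trans d≡c+1 (cong suc (y-at-first qa))) qh)

      -- ... and can return to A only at x, since y sits at position 0.
      rise : ∀ c d → LinNext c d → inA c ≡ false → inA d ≡ true → d ≡ px
      rise c d d≡c+1 right left with isLeft-false (q c) right | isLeft-true (q d) left
      ... | h , qh | a , qa with cross (inj₁ d≡c+1) (inj₂ (qh , qa))
      ... | inj₁ (refl , _) = q-injective (trans qa (sym q-px))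
      ... | inj₂ (refl , _) = ⊥-elim (ℕₚ.0≢1+n (trans (sym (y-at-first qa)) d≡c+1))

      open SingleSwitch inA px (λ c c≡0 → trans (cong isLeft (q-first c c≡0)) (isLeft-↑ˡ y)) fall rise
        pu (trans (cong isLeft q-pu) (isLeft-↑ʳ u))

      px+1≡m : suc (toℕ px) ≡ m
      px+1≡m = prefix-length (proj₁ hq) (toℕ px) (toℕ<n px)
        (λ c c≤px → isLeft-true (q c) (true-upTo c c≤px)) (λ c px<c → isLeft-false (q c) (false-after c px<c))

      left-upTo : ∀ a → toℕ (a ↑ˡ n) ≤ toℕ px
      left-upTo a = subst (_≤ toℕ px) (sym (toℕ-↑ˡ a n)) (ℕₚ.≤-pred (subst (toℕ a <_) (sym px+1≡m) (toℕ<n a)))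

      right-after : ∀ (h : Fin n) → toℕ px < toℕ (m ↑ʳ h)
      right-after h = subst (toℕ px <_) (sym (toℕ-↑ʳ m h))
        (ℕₚ.<-≤-trans (subst (toℕ px <_) px+1≡m (ℕₚ.n<1+n (toℕ px))) (ℕₚ.m≤m+n m (toℕ h)))

    pA : Fin m → Fin m
    pA a = proj₁ (isLeft-true (q (a ↑ˡ n)) (true-upTo _ (left-upTo a)))

    pH : Fin n → Fin n
    pH h = proj₁ (isLeft-false (q (m ↑ʳ h)) (false-after _ (right-after h)))

    q≗concat : ∀ c → q c ≡ concat pA pH c
    q≗concat = ↑-elim m (λ c → q c ≡ concat pA pH c)
      (λ a → trans (proj₂ (isLeft-true (q (a ↑ˡ n)) _)) (sym (concat-↑ˡ pA pH a)))
      (λ h → trans (proj₂ (isLeft-false (q (m ↑ʳ h)) _)) (sym (concat-↑ʳ pA pH h)))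

    pA-last : ∀ a → suc (toℕ a) ≡ m → pA a ≡ x
    pA-last a a+1≡m = Finₚ.↑ˡ-injective n _ _ (begin
      pA a ↑ˡ n        ≡⟨ trans (sym (concat-↑ˡ pA pH a)) (sym (q≗concat (a ↑ˡ n))) ⟩
      q (a ↑ˡ n)       ≡⟨ cong q (toℕ-injective (trans (toℕ-↑ˡ a n) (ℕₚ.suc-injective (trans a+1≡m (sym px+1≡m))))) ⟩
      q px             ≡⟨ q-px ⟩
      x ↑ˡ n           ∎)
      where open ≡-Reasoning

    concat-order : HamCycleOrder spliced E (concat pA pH)
    concat-order = HamCycleOrder-cong {G = spliced} {E} q≗concat hq

    pA-first : ∀ a → toℕ a ≡ 0 → pA a ≡ y
    pA-first a a≡0 = Finₚ.↑ˡ-injective n _ _ (trans (sym (concat-↑ˡ pA pH a))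
      (trans (sym (q≗concat (a ↑ˡ n))) (q-first (a ↑ˡ n) (trans (toℕ-↑ˡ a n) a≡0))))

  -- The orderings are parameters here, so that their definitions are never unfolded.
  module Halves {E} (pA : Fin m → Fin m) (pH : Fin n → Fin n) (order : HamCycleOrder spliced E (concat pA pH))
    (pA-first : ∀ a → toℕ a ≡ 0 → pA a ≡ y) (pA-last : ∀ a → suc (toℕ a) ≡ m → pA a ≡ x) where

    pA-bijective : Bijective _≡_ _≡_ pA
    pA-bijective = proj₁ (concat-bijective⁻¹ (proj₁ order))

    pH-bijective : Bijective _≡_ _≡_ pH
    pH-bijective = proj₂ (concat-bijective⁻¹ (proj₁ order))

    private
      edges : EdgesOf CycNext (concat pA pH) E
      edges = proj₂ (proj₂ order)

      adjacent : ∀ {c d i j} → CycNext c d → concat pA pH c ≡ i → concat pA pH d ≡ j → Adj spliced i j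
      adjacent {c} {d} next e₁ e₂ = subst₂ (Adj spliced) e₁ e₂ (proj₁ (proj₂ order) c d next)

      lastA : Σ (Fin m) λ a → suc (toℕ a) ≡ m
      lastA = lastPosition m≥1
      firstA : Σ (Fin m) λ a → toℕ a ≡ 0
      firstA = firstPosition m≥1

    pH-first : ∀ h → toℕ h ≡ 0 → pH h ≡ u
    pH-first h h≡0 = link-x⇒u (trans (sym (glue-lr (adj A) (adj H) x (pH h)))
      (adjacent (CycNext-left→right (proj₂ lastA) h≡0)
        (trans (concat-↑ˡ pA pH _) (cong (_↑ˡ n) (pA-last _ (proj₂ lastA)))) (concat-↑ʳ pA pH h)))

    pH-last : ∀ h → suc (toℕ h) ≡ n → pH h ≡ v
    pH-last h h+1≡n = link-y⇒v (trans (sym (glue-rl (adj A) (adj H) y (pH h)))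
      (adjacent (CycNext-right→left h+1≡n (proj₂ firstA))
        (concat-↑ʳ pA pH h) (trans (concat-↑ˡ pA pH _) (cong (_↑ˡ n) (pA-first _ (proj₂ firstA))))))

    open SplicedOrder A x y H u v m≥3 n≥1 pA pH (proj₁ pA-bijective) pA-first pA-last pH-first pH-last

    adjacentA : ∀ a b → CycNext a b → Adj A (pA a) (pA b)
    adjacentA a b (inj₁ e) = proj₂ (∧-true {not (isXY (pA a) (pA b))}
      (trans (sym (glue-ll (adj A) (adj H) (pA a) (pA b))) (adjacent (CycNext-↑ˡ e) (concat-↑ˡ pA pH a) (concat-↑ˡ pA pH b))))
    adjacentA a b (inj₂ (a-last , b-first)) = subst₂ (Adj A) (sym (pA-last a a-last)) (sym (pA-first b b-first)) xy

    adjacentH : ∀ h h′ → LinNext h h′ → Adj H (pH h) (pH h′)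
    adjacentH h h′ e = trans (sym (glue-rr (adj A) (adj H) (pH h) (pH h′)))
      (adjacent (CycNext-↑ʳ e) (concat-↑ʳ pA pH h) (concat-↑ʳ pA pH h′))

    private
      entry-leftPart : ∀ i j → entry (leftPart E) i j ≡ (if isXY i j then true else entry E (i ↑ˡ n) (j ↑ˡ n))
      entry-leftPart = entry-fromEntries _

    edgesA : EdgesOf CycNext pA (leftPart E)
    edgesA i j = by-isXY (isXY i j) refl
      where
      by-isXY : ∀ b → isXY i j ≡ b → (leftPart E ∋ₑ i , j) ⇔ Consecutive CycNext pA i j
      by-isXY true t = ≡true-⇔ (trans (entry-leftPart i j) (cong (λ b → if b then true else entry E (i ↑ˡ n) (j ↑ˡ n)) t))
        (λ _ → Equivalence.from consecutive-cyclic (inj₂ t)) (λ _ → refl)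
      by-isXY false t = ≡true-⇔ (trans (entry-leftPart i j) (cong (λ b → if b then true else entry E (i ↑ˡ n) (j ↑ˡ n)) t))
        (λ e → Equivalence.from consecutive-cyclic (inj₁ (Equivalence.to consecutive-left (Equivalence.to (edges _ _) e))))
        (λ c → Equivalence.from (edges _ _) (Equivalence.from consecutive-left
          ([ (λ linear → linear) , (λ xy → ⊥-elim (true≢false (trans (sym xy) t))) ]′ (Equivalence.to consecutive-cyclic c))))

    edgesH : EdgesOf LinNext pH (rightPart E)
    edgesH i j = ≡true-⇔ (entry-fromEntries _ i j)
      (λ e → Equivalence.to consecutive-right (Equivalence.to (edges _ _) e))
      (λ c → Equivalence.from (edges _ _) (Equivalence.from consecutive-right c))

    leftPart-x-y : leftPart E ∋ₑ x , y
    leftPart-x-y = trans (entry-leftPart x y) (cong (λ b → if b then true else entry E (x ↑ˡ n) (y ↑ˡ n)) isXY-x-y)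

    ≡-splicedEdges : E ≡ splicedEdges (leftPart E) (rightPart E)
    ≡-splicedEdges = ≡-fromEntries E _ (↑-elim m (λ i → ∀ j → entry E i j ≡ glued i j)
      (λ a → ↑-elim m (λ j → entry E (a ↑ˡ n) j ≡ glued (a ↑ˡ n) j)
        (λ b → trans (left-left a b) (sym (glue-ll (entry (leftPart E)) (entry (rightPart E)) a b)))
        (λ h → trans (Bool-≡-⇔ (λ e → Equivalence.to consecutive-link (Equivalence.to (edges _ _) e))
                               (λ t → Equivalence.from (edges _ _) (Equivalence.from consecutive-link t)))
                     (sym (glue-lr (entry (leftPart E)) (entry (rightPart E)) a h))))
      (λ h → ↑-elim m (λ j → entry E (m ↑ʳ h) j ≡ glued (m ↑ʳ h) j)
        (λ a → trans (Bool-≡-⇔ (λ e → Equivalence.to consecutive-link (Consecutive-sym (Equivalence.to (edges _ _) e)))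
                               (λ t → Equivalence.from (edges _ _) (Consecutive-sym (Equivalence.from consecutive-link t))))
                     (sym (glue-rl (entry (leftPart E)) (entry (rightPart E)) a h)))
        (λ h′ → trans (sym (entry-fromEntries _ h h′)) (sym (glue-rr (entry (leftPart E)) (entry (rightPart E)) h h′)))))
      where
      glued : Fin (m + n) → Fin (m + n) → Bool
      glued = glue (entry (leftPart E)) (entry (rightPart E))
      -- The entry at (x, y) is false in E but true in leftPart E; the glue masks it again.
      left-left : ∀ a b → entry E (a ↑ˡ n) (b ↑ˡ n) ≡ not (isXY a b) ∧ entry (leftPart E) a b
      left-left a b rewrite entry-leftPart a b with isXY a b in t
      ... | false = refl
      ... | true with entry E (a ↑ˡ n) (b ↑ˡ n) in e
      ... | false = refl
      ... | true = ⊥-elim (true≢false (trans (sym t)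
        (linear-¬isXY (Equivalence.to consecutive-left (Equivalence.to (edges _ _) e)))))

  m+n≥3 : 3 ≤ m + n
  m+n≥3 = ℕₚ.≤-trans m≥3 (ℕₚ.m≤m+n m n)

  compose : ∀ EA EH → IsHamCycle A EA → EA ∋ₑ x , y → IsHamPath H u v EH →
    IsHamCycle spliced (splicedEdges EA EH)
  compose EA EH (_ , p , hp) EA-xy (pH , bijH , pH-first , pH-last , adjacentH , edgesH)
    with HamCycleOrder-fromTo {G = A} {EA} m≥3 x y hp EA-xy
  ... | pA , (bijA , adjacentA , edgesA) , pA-first , pA-last =
    m+n≥3 , concat pA pH , concat-bijective bijA bijH ,
    spliced-adjacent xy adjacentA adjacentH , splicedEdges-order EA EH edgesA edgesH
    where open SplicedOrder A x y H u v m≥3 n≥1 pA pH (proj₁ bijA) pA-first pA-last pH-first pH-last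

  decompose : ∀ E → IsHamCycle spliced E →
    (IsHamCycle A (leftPart E) × leftPart E ∋ₑ x , y) × IsHamPath H u v (rightPart E) ×
    E ≡ splicedEdges (leftPart E) (rightPart E)
  decompose E (_ , p , hp) with HamCycleOrder-startAt-avoiding {G = spliced} {E} m+n≥3 (y ↑ˡ n) (m ↑ʳ v) hp
  ... | q , hq , q-first , q-second =
    ((m≥3 , pA , pA-bijective , adjacentA , edgesA) , leftPart-x-y) ,
    (pH , pH-bijective , pH-first , pH-last , adjacentH , edgesH) , ≡-splicedEdges
    where
    open Blocks {E} hq q-first q-second
    open Halves {E} pA pH concat-order pA-first pA-last

  spliced-count : ∀ {c d} (R : EdgeSet n → Set) → (∀ E → R E → IsHamPath H u v E) →
    HasExactly c (λ E → IsHamCycle A E × E ∋ₑ x , y) → HasExactly d R →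
    HasExactly (c * d) (λ E → IsHamCycle spliced E × R (rightPart E))
  spliced-count R R⇒path = HasExactly-* {P = λ E → IsHamCycle A E × E ∋ₑ x , y} {R} {λ E → IsHamCycle spliced E × R (rightPart E)}
    splicedEdges (λ {a} {a′} {h} {h′} → injective {a} {a′} {h} {h′}) (λ {a} {h} → sound {a} {h}) (λ {E} → complete {E})
    where
    injective : ∀ {a a′ h h′} → IsHamCycle A a × a ∋ₑ x , y → IsHamCycle A a′ × a′ ∋ₑ x , y → R h → R h′ →
      splicedEdges a h ≡ splicedEdges a′ h′ → a ≡ a′ × h ≡ h′
    injective {a} {a′} {h} {h′} (ha , a-xy) (ha′ , a′-xy) _ _ e =
      trans (sym (leftPart-splicedEdges a h a-xy (IsHamCycle-sym {G = A} {a} ha a-xy)))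
        (trans (cong leftPart e) (leftPart-splicedEdges a′ h′ a′-xy (IsHamCycle-sym {G = A} {a′} ha′ a′-xy))) ,
      trans (sym (rightPart-splicedEdges a h)) (trans (cong rightPart e) (rightPart-splicedEdges a′ h′))
    sound : ∀ {a h} → IsHamCycle A a × a ∋ₑ x , y → R h →
      IsHamCycle spliced (splicedEdges a h) × R (rightPart (splicedEdges a h))
    sound {a} {h} (ha , a-xy) rh =
      compose a h ha a-xy (R⇒path h rh) , subst R (sym (rightPart-splicedEdges a h)) rh
    complete : ∀ {E} → IsHamCycle spliced E × R (rightPart E) →
      ∃ λ a → ∃ λ h → (IsHamCycle A a × a ∋ₑ x , y) × R h × E ≡ splicedEdges a h
    complete {E} (hE , rE) = let (cycleA , _ , E≡) = decompose E hE in leftPart E , rightPart E , cycleA , rE , E≡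

-- Iterated splicing

regular⇒order>degree : ∀ {r n} {G : Graph n} → Regular r G → Fin n → r < n
regular⇒order>degree {G = G} regular x =
  subst (_< _) (trans (sym (deg≡count G x)) (regular x)) (count<n (adj G x) x (irref G x))

+-*-suc : ∀ m j n → m + j * n + n ≡ m + suc j * n
+-*-suc m j n = trans (ℕₚ.+-assoc m (j * n) n) (cong (m +_) (ℕₚ.+-comm (j * n) n))

record Rooted (r M c : ℕ) : Set where
  field
    graph : Graph M
    regular : Regular r graph
    order≥3 : 3 ≤ M
    x y : Fin M
    edge : Adj graph x y
    cycles-through : HasExactly c (λ E → IsHamCycle graph E × E ∋ₑ x , y)

RegularWithHamCycles : ℕ → ℕ → ℕ → Set
RegularWithHamCycles r N c = Σ (Graph N) λ G → Regular r G × HasExactly c (IsHamCycle G)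

module Gadget (r : ℕ) (r≥1 : 1 ≤ r) {n : ℕ} (H : Graph n) (u v : Fin n) (u≢v : u ≢ v)
  (du : deg H u ≡ r ∸ 1) (dv : deg H v ≡ r ∸ 1) (dw : ∀ w → w ≢ u → w ≢ v → deg H w ≡ r)
  (c₂ : ℕ) (paths : HasExactly c₂ (IsHamPath H u v))
  (x′ y′ : Fin n) (x′y′ : Adj H x′ y′)
  (c₃ : ℕ) (paths-through : HasExactly c₃ (λ E → IsHamPath H u v E × E ∋ₑ x′ , y′)) where

  module _ {M c} (R : Rooted r M c) where
    open Rooted R
    open Splice graph x y H u v
    open SplicedCycles graph x y H u v order≥3 u≢v edge

    splice-regular : Regular r spliced
    splice-regular = spliced-regular r r≥1 regular edge u≢v du dv dw

    splice-cycles : HasExactly (c * c₂) (IsHamCycle spliced)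
    splice-cycles = HasExactly-cong (λ E → mk⇔ proj₁ (λ hE → hE , proj₁ (proj₂ (decompose E hE))))
      (spliced-count (IsHamPath H u v) (λ _ p → p) cycles-through paths)

    splice : Rooted r (M + n) (c * c₃)
    splice = record
      { graph = spliced
      ; regular = splice-regular
      ; order≥3 = m+n≥3
      ; x = M ↑ʳ x′
      ; y = M ↑ʳ y′
      ; edge = trans (glue-rr (adj graph) (adj H) x′ y′) x′y′
      ; cycles-through = HasExactly-cong through-x′y′
          (spliced-count (λ E → IsHamPath H u v E × E ∋ₑ x′ , y′) (λ _ → proj₁) cycles-through paths-through)
      }
      where
      entry-x′y′ : ∀ E → entry (rightPart E) x′ y′ ≡ entry E (M ↑ʳ x′) (M ↑ʳ y′)
      entry-x′y′ E = entry-fromEntries _ x′ y′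
      through-x′y′ : ∀ E → (IsHamCycle spliced E × (IsHamPath H u v (rightPart E) × rightPart E ∋ₑ x′ , y′))
                           ⇔ (IsHamCycle spliced E × E ∋ₑ (M ↑ʳ x′) , (M ↑ʳ y′))
      through-x′y′ E = mk⇔ (λ (hE , _ , e) → hE , trans (sym (entry-x′y′ E)) e)
                           (λ (hE , e) → hE , proj₁ (proj₂ (decompose E hE)) , trans (entry-x′y′ E) e)

  iterate : ∀ {M c} j → Rooted r M c → Rooted r (M + j * n) (c * c₃ ^ j)
  iterate {M} {c} zero R =
    subst₂ (Rooted r) (sym (ℕₚ.+-identityʳ M)) (sym (ℕₚ.*-identityʳ c)) R
  iterate {M} {c} (suc j) R = subst₂ (Rooted r) (+-*-suc M j n) cycles (splice (iterate j R))
    where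
    cycles : c * c₃ ^ j * c₃ ≡ c * c₃ ^ suc j
    cycles = trans (ℕₚ.*-assoc c (c₃ ^ j) c₃) (cong (c *_) (ℕₚ.*-comm (c₃ ^ j) c₃))

mainTheorem3 : (r : ℕ) → 2 ≤ r →
    (n₁ : ℕ) (G : Graph n₁) → Regular r G →
    (x y : Fin n₁) → Adj G x y →
    (c₁ : ℕ) → HasExactly c₁ (λ E → IsHamCycle G E × (E ∋ₑ x , y)) →
    (n₂ : ℕ) (H : Graph n₂) (u v : Fin n₂) → u ≢ v →
    deg H u ≡ r ∸ 1 → deg H v ≡ r ∸ 1 →
    (∀ w → w ≢ u → w ≢ v → deg H w ≡ r) →
    (c₂ : ℕ) → HasExactly c₂ (IsHamPath H u v) →
    (x′ y′ : Fin n₂) → Adj H x′ y′ →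
    (c₃ : ℕ) → HasExactly c₃ (λ E → IsHamPath H u v E × (E ∋ₑ x′ , y′)) →
    (k : ℕ) → 1 ≤ k →
    Σ (Graph (n₁ + k * n₂)) λ Gk →
      Regular r Gk × HasExactly (c₁ * c₂ * c₃ ^ (k ∸ 1)) (IsHamCycle Gk)
mainTheorem3 r r≥2 n₁ G regular x y xy c₁ cycles n₂ H u v u≢v du dv dw c₂ paths x′ y′ x′y′ c₃ paths-through (suc j) _ =
  subst₂ (RegularWithHamCycles r) (+-*-suc n₁ j n₂) cycle-count
    (Rooted.graph (splice Gⱼ) , Rooted.regular (splice Gⱼ) , splice-cycles Gⱼ)
  where
  open Gadget r (ℕₚ.≤-trans (s≤s z≤n) r≥2) H u v u≢v du dv dw c₂ paths x′ y′ x′y′ c₃ paths-through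
  G₀ : Rooted r n₁ c₁
  G₀ = record { graph = G ; regular = regular ; order≥3 = ℕₚ.≤-trans (s≤s r≥2) (regular⇒order>degree {G = G} regular x)
              ; x = x ; y = y ; edge = xy ; cycles-through = cycles }
  Gⱼ : Rooted r (n₁ + j * n₂) (c₁ * c₃ ^ j)
  Gⱼ = iterate j G₀
  cycle-count : c₁ * c₃ ^ j * c₂ ≡ c₁ * c₂ * c₃ ^ j
  cycle-count = trans (ℕₚ.*-assoc c₁ (c₃ ^ j) c₂)
    (trans (cong (c₁ *_) (ℕₚ.*-comm (c₃ ^ j) c₂)) (sym (ℕₚ.*-assoc c₁ c₂ (c₃ ^ j))))
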